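{- A cartesian bicategory with enough maps satisfies the axiom of choice if and only if every surjective map $\pi\colon X\to Y$ splits, i.e. there is a map $h\colon Y\to X$ with $h;\pi=\mathrm{id}_Y$.
   Context: Composition is diagrammatic ($R;S$ means first $R$ then $S$). A cartesian bicategory is a (strict) symmetric monoidal category $(\mathcal{B},\otimes,I)$ with symmetry $\sigma$, enriched over posets (hom-sets ordered by $\le$, with $;$ and $\otimes$ monotone), where every object $X$ has $\delta_X\colon X\to X\otimes X$, $\varepsilon_X\colon X\to I$ such that: (1) they form a cocommutative comonoid; (2) they have right adjoints $\delta_X^*,\varepsilon_X^*$: $\mathrm{id}_X\le\delta_X;\delta_X^*$, $\delta_X^*;\delta_X\le\mathrm{id}$, $\mathrm{id}_X\le\varepsilon_X;\varepsilon_X^*$, $\varepsilon_X^*;\varepsilon_X\le\mathrm{id}_I$; (3) $\delta_X^*;\delta_X=(\mathrm{id}_X\otimes\delta_X);(\delta_X^*\otimes\mathrm{id}_X)$; (4) every $R\colon X\to Y$ satisfies $R;\delta_Y\le\delta_X;(R\otimes R)$ and $R;\varepsilon_Y\le\varepsilon_X$; (5) $\varepsilon_{X\otimes Y}=\varepsilon_X\otimes\varepsilon_Y$, $\delta_{X\otimes Y}=(\delta_X\otimes\delta_Y);(\mathrm{id}\otimes\sigma_{X,Y}\otimes\mathrm{id})$, $\varepsilon_I=\delta_I=\mathrm{id}_I$. $R^{op}=(\mathrm{id}_Y\otimes(\varepsilon_X^*;\delta_X));(\mathrm{id}_Y\otimes R\otimes\mathrm{id}_X);((\delta_Y^*;\varepsilon_Y)\otimes\mathrm{id}_X)\colon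 Y\to X$. $R\colon X\to Y$ is single valued if $\delta_X;(R\otimes R)\le R;\delta_Y$, total if $\varepsilon_X\le R;\varepsilon_Y$, surjective if $\varepsilon_Y^*\le\varepsilon_X^*;R$. A map is a single valued total morphism. Axiom of choice: for every total $R\colon X\to Y$ there is a map $f\colon X\to Y$ with $f\le R$. Enough maps: for every $R\colon X\to I$ there is a map $f\colon Z\to X$ with $R=f^{op};\varepsilon_Z$. -}

module Defs where

open import Level using (Level; _⊔_) renaming (suc to lsuc)
open import Data.Product using (Σ; _×_; _,_)
open import Relation.Binary.Structures using (IsPartialOrder)
open import Relation.Binary.PropositionalEquality
  using (_≡_; refl; sym; trans; cong; cong₂; subst₂)

-- Strict symmetric monoidal poset-enriched category with cartesian structure
-- (a cartesian bicategory, following the paper).  Strictness of the tensor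
-- on objects is expressed by propositional equalities of objects, and the
-- corresponding equations on morphisms are stated up to transport ("cast").
-- Composition is diagrammatic: f ⨾ g means first f then g.

record CartesianBicategory (o ℓ e : Level) : Set (lsuc (o ⊔ ℓ ⊔ e)) where
  infixr 9 _⨾_
  infixr 10 _⊗₀_ _⊗₁_
  infix 4 _≤_
  field
    Obj : Set o
    Hom : Obj → Obj → Set ℓ
    _≤_ : ∀ {X Y} → Hom X Y → Hom X Y → Set e
    ≤-isPartialOrder : ∀ {X Y} → IsPartialOrder (_≡_ {A = Hom X Y}) _≤_

    id : ∀ {X} → Hom X X
    _⨾_ : ∀ {X Y Z} → Hom X Y → Hom Y Z → Hom X Z
    identityˡ : ∀ {X Y} (f : Hom X Y) → id ⨾ f ≡ f
    identityʳ : ∀ {X Y} (f : Hom X Y) → f ⨾ id ≡ f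
    assoc : ∀ {X Y Z W} (f : Hom X Y) (g : Hom Y Z) (h : Hom Z W) →
            (f ⨾ g) ⨾ h ≡ f ⨾ (g ⨾ h)
    ⨾-mono : ∀ {X Y Z} {f f' : Hom X Y} {g g' : Hom Y Z} →
             f ≤ f' → g ≤ g' → f ⨾ g ≤ f' ⨾ g'

    _⊗₀_ : Obj → Obj → Obj
    I : Obj
    _⊗₁_ : ∀ {X Y X' Y'} → Hom X Y → Hom X' Y' → Hom (X ⊗₀ X') (Y ⊗₀ Y')
    ⊗-id : ∀ {X Y} → id {X} ⊗₁ id {Y} ≡ id
    ⊗-⨾ : ∀ {X Y Z X' Y' Z'} (f : Hom X Y) (g : Hom Y Z) (f' : Hom X' Y') (g' : Hom Y' Z') →
          (f ⨾ g) ⊗₁ (f' ⨾ g') ≡ (f ⊗₁ f') ⨾ (g ⊗₁ g')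
    ⊗-mono : ∀ {X Y X' Y'} {f g : Hom X Y} {f' g' : Hom X' Y'} →
             f ≤ g → f' ≤ g' → f ⊗₁ f' ≤ g ⊗₁ g'
    assoc₀ : ∀ X Y Z → (X ⊗₀ Y) ⊗₀ Z ≡ X ⊗₀ (Y ⊗₀ Z)
    unitˡ₀ : ∀ X → I ⊗₀ X ≡ X
    unitʳ₀ : ∀ X → X ⊗₀ I ≡ X

  cast : ∀ {X X' Y Y'} → X ≡ X' → Y ≡ Y' → Hom X Y → Hom X' Y'
  cast p q f = subst₂ Hom p q f

  field
    assoc₁ : ∀ {X Y Z X' Y' Z'} (f : Hom X X') (g : Hom Y Y') (h : Hom Z Z') →
             cast (assoc₀ X Y Z) (assoc₀ X' Y' Z') ((f ⊗₁ g) ⊗₁ h) ≡ f ⊗₁ (g ⊗₁ h)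
    unitˡ₁ : ∀ {X Y} (f : Hom X Y) → cast (unitˡ₀ X) (unitˡ₀ Y) (id {I} ⊗₁ f) ≡ f
    unitʳ₁ : ∀ {X Y} (f : Hom X Y) → cast (unitʳ₀ X) (unitʳ₀ Y) (f ⊗₁ id {I}) ≡ f

    σ : ∀ {X Y} → Hom (X ⊗₀ Y) (Y ⊗₀ X)
    σ-natural : ∀ {X Y X' Y'} (f : Hom X Y) (g : Hom X' Y') →
                (f ⊗₁ g) ⨾ σ ≡ σ ⨾ (g ⊗₁ f)
    σ-involutive : ∀ {X Y} → σ {X} {Y} ⨾ σ {Y} {X} ≡ id
    σ-hexagon : ∀ {X Y Z} →
                σ {X} {Y ⊗₀ Z} ≡
                cast (assoc₀ X Y Z) refl
                  ((σ {X} {Y} ⊗₁ id {Z}) ⨾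
                   cast (sym (assoc₀ Y X Z)) (sym (assoc₀ Y Z X)) (id {Y} ⊗₁ σ {X} {Z}))

    δ : ∀ {X} → Hom X (X ⊗₀ X)
    ε : ∀ {X} → Hom X I
    δ* : ∀ {X} → Hom (X ⊗₀ X) X
    ε* : ∀ {X} → Hom I X

    δ-coassoc : ∀ {X} →
                cast refl (assoc₀ X X X) (δ {X} ⨾ (δ {X} ⊗₁ id {X})) ≡ δ ⨾ (id ⊗₁ δ)
    δ-counitˡ : ∀ {X} → cast refl (unitˡ₀ X) (δ {X} ⨾ (ε {X} ⊗₁ id {X})) ≡ id
    δ-counitʳ : ∀ {X} → cast refl (unitʳ₀ X) (δ {X} ⨾ (id {X} ⊗₁ ε {X})) ≡ id
    δ-cocomm : ∀ {X} → δ {X} ⨾ σ ≡ δ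

    δ-unit : ∀ {X} → id {X} ≤ δ ⨾ δ*
    δ-counit : ∀ {X} → δ* ⨾ δ ≤ id {X ⊗₀ X}
    ε-unit : ∀ {X} → id {X} ≤ ε ⨾ ε*
    ε-counit : ∀ {X} → ε* {X} ⨾ ε ≤ id {I}

    frobenius : ∀ {X} →
                δ* {X} ⨾ δ ≡ (id {X} ⊗₁ δ {X}) ⨾ cast (assoc₀ X X X) refl (δ* {X} ⊗₁ id {X})

    δ-lax : ∀ {X Y} (R : Hom X Y) → R ⨾ δ ≤ δ ⨾ (R ⊗₁ R)
    ε-lax : ∀ {X Y} (R : Hom X Y) → R ⨾ ε ≤ ε

    ε-⊗ : ∀ {X Y} → ε {X ⊗₀ Y} ≡ cast refl (unitˡ₀ I) (ε {X} ⊗₁ ε {Y})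
    δ-⊗ : ∀ {X Y} →
          δ {X ⊗₀ Y} ≡
          (δ {X} ⊗₁ δ {Y}) ⨾
          cast (sym (trans (assoc₀ X X (Y ⊗₀ Y)) (cong (X ⊗₀_) (sym (assoc₀ X Y Y)))))
               (trans (cong (X ⊗₀_) (assoc₀ Y X Y)) (sym (assoc₀ X Y (X ⊗₀ Y))))
               (id {X} ⊗₁ (σ {X} {Y} ⊗₁ id {Y}))
    ε-I : ε {I} ≡ id
    δ-I : cast refl (unitˡ₀ I) (δ {I}) ≡ id

module _ {o ℓ e : Level} (C : CartesianBicategory o ℓ e) where
  open CartesianBicategory C

  _ᵒᵖ : ∀ {X Y} → Hom X Y → Hom Y X
  _ᵒᵖ {X} {Y} R =
    cast (unitʳ₀ Y) refl (id {Y} ⊗₁ (ε* {X} ⨾ δ {X})) ⨾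
    (id {Y} ⊗₁ (R ⊗₁ id {X})) ⨾
    cast (assoc₀ Y Y X) (unitˡ₀ X) ((δ* {Y} ⨾ ε {Y}) ⊗₁ id {X})

  SingleValued : ∀ {X Y} → Hom X Y → Set e
  SingleValued R = δ ⨾ (R ⊗₁ R) ≤ R ⨾ δ

  Total : ∀ {X Y} → Hom X Y → Set e
  Total R = ε ≤ R ⨾ ε

  Surjective : ∀ {X Y} → Hom X Y → Set e
  Surjective {X} R = ε* ≤ ε* {X} ⨾ R

  IsMap : ∀ {X Y} → Hom X Y → Set e
  IsMap R = SingleValued R × Total R

  AxiomOfChoice : Set (o ⊔ ℓ ⊔ e)
  AxiomOfChoice = ∀ {X Y} (R : Hom X Y) → Total R →
                  Σ (Hom X Y) λ f → IsMap f × f ≤ R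

  EnoughMaps : Set (o ⊔ ℓ ⊔ e)
  EnoughMaps = ∀ {X} (R : Hom X I) →
               Σ Obj λ Z → Σ (Hom Z X) λ f → IsMap f × (R ≡ (f ᵒᵖ) ⨾ ε {Z})

  SurjectiveMapsSplit : Set (o ⊔ ℓ ⊔ e)
  SurjectiveMapsSplit = ∀ {X Y} (π : Hom X Y) → IsMap π → Surjective π →
                        Σ (Hom Y X) λ h → IsMap h × (h ⨾ π ≡ id)

-- (⇒) The converse π° of a surjective map π is total, so choice yields a map h ≤ π°;
-- then h ⨾ π ≤ π° ⨾ π ≤ id, and a map below the identity is the identity.
-- (⇐) For a total R : X → Y, enough maps tabulate the predicate (R ⊗ id) ⨾ cap on X ⊗ Y by
-- a map f : Z → X ⊗ Y.  Totality of R makes f ⨾ π₁ surjective; a splitting h of it gives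
-- the map g = h ⨾ f ⨾ π₂, whose meet with R is total.  A single-valued relation lies below
-- every relation it meets totally, so g ≤ R.  The calculations live in the compact closed
-- structure cup = ε* ⨾ δ, cap = δ* ⨾ ε, where the converse R° is R bent by cup and cap.
module Submission where

open import Defs
open import Level using (Level; _⊔_)
open import Function.Bundles using (_⇔_; mk⇔)
open import Data.Product using (Σ; _×_; _,_; proj₁; proj₂)
open import Relation.Binary.Bundles using (Poset)
open import Relation.Binary.PropositionalEquality
open import Axiom.UniquenessOfIdentityProofs.WithK using (uip)
import Relation.Binary.Reasoning.PartialOrder as PosetReasoning


module HomReasoning {o ℓ e : Level} (C : CartesianBicategory o ℓ e) where
  open CartesianBicategory C

  homPoset : Obj → Obj → Poset ℓ ℓ e
  homPoset X Y = record { isPartialOrder = ≤-isPartialOrder {X} {Y} }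

  module ≤-Reasoning {X Y : Obj} = PosetReasoning (homPoset X Y)

  open module HomPoset {X Y : Obj} = Poset (homPoset X Y) public
    using () renaming (refl to ≤-refl; reflexive to ≤-reflexive; trans to ≤-trans; antisym to ≤-antisym)

  ⨾-monoˡ : ∀ {X Y Z} {f f′ : Hom X Y} (g : Hom Y Z) → f ≤ f′ → f ⨾ g ≤ f′ ⨾ g
  ⨾-monoˡ g p = ⨾-mono p ≤-refl

  ⨾-monoʳ : ∀ {X Y Z} (f : Hom X Y) {g g′ : Hom Y Z} → g ≤ g′ → f ⨾ g ≤ f ⨾ g′
  ⨾-monoʳ f p = ⨾-mono ≤-refl p

  ⊗-monoˡ : ∀ {X Y X′ Y′} {f f′ : Hom X Y} (g : Hom X′ Y′) → f ≤ f′ → f ⊗₁ g ≤ f′ ⊗₁ g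
  ⊗-monoˡ g p = ⊗-mono p ≤-refl

  ⊗-monoʳ : ∀ {X Y X′ Y′} (f : Hom X Y) {g g′ : Hom X′ Y′} → g ≤ g′ → f ⊗₁ g ≤ f ⊗₁ g′
  ⊗-monoʳ f p = ⊗-mono ≤-refl p

  pullˡ : ∀ {A B D E} {a : Hom A B} {b : Hom B D} {c : Hom A D} {d : Hom D E} →
          a ⨾ b ≡ c → a ⨾ b ⨾ d ≡ c ⨾ d
  pullˡ {a = a} {b} {d = d} p = trans (sym (assoc a b d)) (cong (_⨾ d) p)

  pushˡ : ∀ {A B D E} {a : Hom A B} {b : Hom B D} {c : Hom A D} {d : Hom D E} →
          c ≡ a ⨾ b → c ⨾ d ≡ a ⨾ b ⨾ d
  pushˡ p = sym (pullˡ (sym p))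

  pull₃ˡ : ∀ {A B D E F} {a : Hom A B} {b : Hom B D} {c : Hom D E} {x : Hom A E} {r : Hom E F} →
           a ⨾ b ⨾ c ≡ x → a ⨾ b ⨾ c ⨾ r ≡ x ⨾ r
  pull₃ˡ {a = a} {b} {c} {r = r} p = trans (cong (a ⨾_) (sym (assoc b c r))) (pullˡ p)

  extend : ∀ {A B B′ D E} {a : Hom A B} {b : Hom B D} {c : Hom A B′} {d : Hom B′ D} {r : Hom D E} →
           a ⨾ b ≡ c ⨾ d → a ⨾ b ⨾ r ≡ c ⨾ d ⨾ r
  extend {a = a} {b} {c} {d} {r} p = trans (sym (assoc a b r)) (trans (cong (_⨾ r) p) (assoc c d r))

  cancelʳ : ∀ {A B D} {a : Hom A B} {b : Hom B D} {c : Hom D B} → b ⨾ c ≡ id → a ⨾ b ⨾ c ≡ a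
  cancelʳ {a = a} p = trans (cong (a ⨾_) p) (identityʳ a)

  inverse-unique : ∀ {A B} {x : Hom A B} {c : Hom B A} {c′ : Hom A B} →
                   x ⨾ c ≡ id → c ⨾ c′ ≡ id → x ≡ c′
  inverse-unique {x = x} {c} {c′} p q =
    trans (sym (cancelʳ q)) (trans (pullˡ p) (identityˡ c′))

  id⊗-⨾ : ∀ {A X Y Z} (f : Hom X Y) (g : Hom Y Z) → id {A} ⊗₁ (f ⨾ g) ≡ (id ⊗₁ f) ⨾ (id ⊗₁ g)
  id⊗-⨾ f g = trans (cong (_⊗₁ (f ⨾ g)) (sym (identityˡ id))) (⊗-⨾ id id f g)

  ⨾-⊗id : ∀ {A X Y Z} (f : Hom X Y) (g : Hom Y Z) → (f ⨾ g) ⊗₁ id {A} ≡ (f ⊗₁ id) ⨾ (g ⊗₁ id)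
  ⨾-⊗id f g = trans (cong ((f ⨾ g) ⊗₁_) (sym (identityˡ id))) (⊗-⨾ f g id id)

  id⊗⨾⊗ : ∀ {A B X Y Z} (a : Hom X Y) (u : Hom A B) (b : Hom Y Z) → (id ⊗₁ a) ⨾ (u ⊗₁ b) ≡ u ⊗₁ (a ⨾ b)
  id⊗⨾⊗ a u b = trans (sym (⊗-⨾ id u a b)) (cong (_⊗₁ (a ⨾ b)) (identityˡ u))

  ⊗⨾id⊗ : ∀ {A B X Y Z} (u : Hom A B) (a : Hom X Y) (b : Hom Y Z) → (u ⊗₁ a) ⨾ (id ⊗₁ b) ≡ u ⊗₁ (a ⨾ b)
  ⊗⨾id⊗ u a b = trans (sym (⊗-⨾ u id a b)) (cong (_⊗₁ (a ⨾ b)) (identityʳ u))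

  ⊗⨾⊗id : ∀ {A B D X Y} (u : Hom A B) (a : Hom X Y) (b : Hom B D) → (u ⊗₁ a) ⨾ (b ⊗₁ id) ≡ (u ⨾ b) ⊗₁ a
  ⊗⨾⊗id u a b = trans (sym (⊗-⨾ u b a id)) (cong ((u ⨾ b) ⊗₁_) (identityʳ a))

  ⊗id⨾id⊗ : ∀ {X Y X′ Y′} (f : Hom X Y) (g : Hom X′ Y′) → (f ⊗₁ id) ⨾ (id ⊗₁ g) ≡ f ⊗₁ g
  ⊗id⨾id⊗ f g = trans (⊗⨾id⊗ f id g) (cong (f ⊗₁_) (identityˡ g))

  id⊗⨾⊗id : ∀ {X Y X′ Y′} (f : Hom X Y) (g : Hom X′ Y′) → (id ⊗₁ g) ⨾ (f ⊗₁ id) ≡ f ⊗₁ g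
  id⊗⨾⊗id f g = trans (id⊗⨾⊗ g f id) (cong (f ⊗₁_) (identityʳ g))

  ⊗-slide : ∀ {X Y X′ Y′} (f : Hom X Y) (g : Hom X′ Y′) → (f ⊗₁ id) ⨾ (id ⊗₁ g) ≡ (id ⊗₁ g) ⨾ (f ⊗₁ id)
  ⊗-slide f g = trans (⊗id⨾id⊗ f g) (sym (id⊗⨾⊗id f g))

  assoc₃ : ∀ {A B D E F} (a : Hom A B) (b : Hom B D) (c : Hom D E) (d : Hom E F) →
           (a ⨾ b ⨾ c) ⨾ d ≡ a ⨾ b ⨾ c ⨾ d
  assoc₃ a b c d = trans (assoc a (b ⨾ c) d) (cong (a ⨾_) (assoc b c d))


module Coherence {o ℓ e : Level} (C : CartesianBicategory o ℓ e) where
  open CartesianBicategory C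
  open HomReasoning C
  open ≤-Reasoning

  coe : ∀ {A B} → A ≡ B → Hom A B
  coe refl = id

  coe-irrelevant : ∀ {A B} (p q : A ≡ B) → coe p ≡ coe q
  coe-irrelevant p q = cong coe (uip p q)

  coe-⨾ : ∀ {A B D} (p : A ≡ B) (q : B ≡ D) → coe p ⨾ coe q ≡ coe (trans p q)
  coe-⨾ refl refl = identityˡ id

  coe-⊗ : ∀ {A B A′ B′} (p : A ≡ B) (q : A′ ≡ B′) → coe p ⊗₁ coe q ≡ coe (cong₂ _⊗₀_ p q)
  coe-⊗ refl refl = ⊗-id

  coe-inverseʳ : ∀ {A B} (p : A ≡ B) → coe p ⨾ coe (sym p) ≡ id
  coe-inverseʳ refl = identityˡ id

  cast≡coe : ∀ {X X′ Y Y′} (p : X ≡ X′) (q : Y ≡ Y′) (f : Hom X Y) → cast p q f ≡ coe (sym p) ⨾ f ⨾ coe q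
  cast≡coe refl refl f = sym (trans (identityˡ _) (identityʳ f))

  cast-square : ∀ {X X′ Y Y′} (p : X ≡ X′) (q : Y ≡ Y′) {f : Hom X Y} {g : Hom X′ Y′} →
                cast p q f ≡ g → f ⨾ coe q ≡ coe p ⨾ g
  cast-square refl refl refl = trans (identityʳ _) (sym (identityˡ _))

  coe-square-inverse : ∀ {A A′ B B′} (p : A ≡ A′) (q : B ≡ B′) {f : Hom A B} {g : Hom A′ B′} →
                       f ⨾ coe q ≡ coe p ⨾ g → coe (sym p) ⨾ f ≡ g ⨾ coe (sym q)
  coe-square-inverse refl refl {f} {g} h = begin-equality
    id ⨾ f  ≡⟨ identityˡ f ⟩
    f       ≡⟨ identityʳ f ⟨
    f ⨾ id  ≡⟨ h ⟩
    id ⨾ g  ≡⟨ identityˡ g ⟩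
    g       ≡⟨ identityʳ g ⟨
    g ⨾ id  ∎

  -- The tensor is strict only up to propositional equality of objects, so structural
  -- isomorphisms are transports; by UIP any two of them with the same type coincide.
  Structural : ∀ {A B} → Hom A B → Set (o ⊔ ℓ)
  Structural {A} {B} f = Σ (A ≡ B) λ p → f ≡ coe p

  structural-coe : ∀ {A B} (p : A ≡ B) → Structural (coe p)
  structural-coe p = p , refl

  instance
    structural-id : ∀ {A} → Structural (id {A})
    structural-id = refl , refl

    structural-⨾ : ∀ {A B D} {f : Hom A B} {g : Hom B D} → {{Structural f}} → {{Structural g}} → Structural (f ⨾ g)
    structural-⨾ {{p , refl}} {{q , refl}} = trans p q , coe-⨾ p q

    structural-⊗ : ∀ {A B A′ B′} {f : Hom A B} {g : Hom A′ B′} → {{Structural f}} → {{Structural g}} → Structural (f ⊗₁ g)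
    structural-⊗ {{p , refl}} {{q , refl}} = cong₂ _⊗₀_ p q , coe-⊗ p q

  coherence : ∀ {A B} {f g : Hom A B} {{sf : Structural f}} {{sg : Structural g}} → f ≡ g
  coherence {{p , refl}} {{q , refl}} = coe-irrelevant p q

  structural-cancelˡ : ∀ {A B D} {c : Hom A B} {x y : Hom B D} → {{Structural c}} → c ⨾ x ≡ c ⨾ y → x ≡ y
  structural-cancelˡ {x = x} {y} {{refl , refl}} p = trans (sym (identityˡ x)) (trans p (identityˡ y))

  structural-cancelʳ : ∀ {A B D} {c : Hom B D} {x y : Hom A B} → {{Structural c}} → x ⨾ c ≡ y ⨾ c → x ≡ y
  structural-cancelʳ {x = x} {y} {{refl , refl}} p = trans (sym (identityʳ x)) (trans p (identityʳ y))

  λ⇒ : ∀ {A} → Hom (I ⊗₀ A) A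
  λ⇒ {A} = coe (unitˡ₀ A)

  λ⇐ : ∀ {A} → Hom A (I ⊗₀ A)
  λ⇐ {A} = coe (sym (unitˡ₀ A))

  ρ⇒ : ∀ {A} → Hom (A ⊗₀ I) A
  ρ⇒ {A} = coe (unitʳ₀ A)

  ρ⇐ : ∀ {A} → Hom A (A ⊗₀ I)
  ρ⇐ {A} = coe (sym (unitʳ₀ A))

  α⇒ : ∀ {A B D} → Hom ((A ⊗₀ B) ⊗₀ D) (A ⊗₀ (B ⊗₀ D))
  α⇒ {A} {B} {D} = coe (assoc₀ A B D)

  α⇐ : ∀ {A B D} → Hom (A ⊗₀ (B ⊗₀ D)) ((A ⊗₀ B) ⊗₀ D)
  α⇐ {A} {B} {D} = coe (sym (assoc₀ A B D))

  instance
    λ⇒-structural : ∀ {A} → Structural (λ⇒ {A})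
    λ⇒-structural {A} = structural-coe (unitˡ₀ A)

    λ⇐-structural : ∀ {A} → Structural (λ⇐ {A})
    λ⇐-structural {A} = structural-coe (sym (unitˡ₀ A))

    ρ⇒-structural : ∀ {A} → Structural (ρ⇒ {A})
    ρ⇒-structural {A} = structural-coe (unitʳ₀ A)

    ρ⇐-structural : ∀ {A} → Structural (ρ⇐ {A})
    ρ⇐-structural {A} = structural-coe (sym (unitʳ₀ A))

    α⇒-structural : ∀ {A B D} → Structural (α⇒ {A} {B} {D})
    α⇒-structural {A} {B} {D} = structural-coe (assoc₀ A B D)

    α⇐-structural : ∀ {A B D} → Structural (α⇐ {A} {B} {D})
    α⇐-structural {A} {B} {D} = structural-coe (sym (assoc₀ A B D))

  λ⇒⨾λ⇐ : ∀ {A} → λ⇒ {A} ⨾ λ⇐ ≡ id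
  λ⇒⨾λ⇐ {A} = coe-inverseʳ (unitˡ₀ A)

  ρ⇒⨾ρ⇐ : ∀ {A} → ρ⇒ {A} ⨾ ρ⇐ ≡ id
  ρ⇒⨾ρ⇐ {A} = coe-inverseʳ (unitʳ₀ A)

  ρ⇐⨾ρ⇒ : ∀ {A} → ρ⇐ {A} ⨾ ρ⇒ ≡ id
  ρ⇐⨾ρ⇒ = coherence

  λ⇐⨾λ⇒ : ∀ {A} → λ⇐ {A} ⨾ λ⇒ ≡ id
  λ⇐⨾λ⇒ = coherence

  α⇒⨾α⇐ : ∀ {A B D} → α⇒ {A} {B} {D} ⨾ α⇐ ≡ id
  α⇒⨾α⇐ {A} {B} {D} = coe-inverseʳ (assoc₀ A B D)

  λ⇒-natural : ∀ {X Y} (f : Hom X Y) → (id {I} ⊗₁ f) ⨾ λ⇒ ≡ λ⇒ ⨾ f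
  λ⇒-natural {X} {Y} f = cast-square (unitˡ₀ X) (unitˡ₀ Y) (unitˡ₁ f)

  λ⇐-natural : ∀ {X Y} (f : Hom X Y) → λ⇐ ⨾ (id {I} ⊗₁ f) ≡ f ⨾ λ⇐
  λ⇐-natural {X} {Y} f = coe-square-inverse (unitˡ₀ X) (unitˡ₀ Y) (λ⇒-natural f)

  ρ⇒-natural : ∀ {X Y} (f : Hom X Y) → (f ⊗₁ id {I}) ⨾ ρ⇒ ≡ ρ⇒ ⨾ f
  ρ⇒-natural {X} {Y} f = cast-square (unitʳ₀ X) (unitʳ₀ Y) (unitʳ₁ f)

  ρ⇐-natural : ∀ {X Y} (f : Hom X Y) → ρ⇐ ⨾ (f ⊗₁ id {I}) ≡ f ⨾ ρ⇐
  ρ⇐-natural {X} {Y} f = coe-square-inverse (unitʳ₀ X) (unitʳ₀ Y) (ρ⇒-natural f)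

  α⇒-natural : ∀ {X Y Z X′ Y′ Z′} (f : Hom X X′) (g : Hom Y Y′) (h : Hom Z Z′) →
               ((f ⊗₁ g) ⊗₁ h) ⨾ α⇒ ≡ α⇒ ⨾ (f ⊗₁ (g ⊗₁ h))
  α⇒-natural {X} {Y} {Z} {X′} {Y′} {Z′} f g h = cast-square (assoc₀ X Y Z) (assoc₀ X′ Y′ Z′) (assoc₁ f g h)

  α⇐-natural : ∀ {X Y Z X′ Y′ Z′} (f : Hom X X′) (g : Hom Y Y′) (h : Hom Z Z′) →
               α⇐ ⨾ ((f ⊗₁ g) ⊗₁ h) ≡ (f ⊗₁ (g ⊗₁ h)) ⨾ α⇐
  α⇐-natural {X} {Y} {Z} {X′} {Y′} {Z′} f g h =
    coe-square-inverse (assoc₀ X Y Z) (assoc₀ X′ Y′ Z′) (α⇒-natural f g h)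

  ⊗idI-conjugate : ∀ {X Y} (f : Hom X Y) → f ⊗₁ id {I} ≡ ρ⇒ ⨾ f ⨾ ρ⇐
  ⊗idI-conjugate f = trans (sym (cancelʳ ρ⇒⨾ρ⇐)) (extend (ρ⇒-natural f))

  idI⊗-conjugate : ∀ {X Y} (f : Hom X Y) → id {I} ⊗₁ f ≡ λ⇒ ⨾ f ⨾ λ⇐
  idI⊗-conjugate f = trans (sym (cancelʳ λ⇒⨾λ⇐)) (extend (λ⇒-natural f))

  σ-transport : ∀ {X B B′} (u : B ≡ B′) →
                σ {X} {B} ≡ coe (cong (X ⊗₀_) u) ⨾ σ ⨾ coe (cong (_⊗₀ X) (sym u))
  σ-transport refl = sym (trans (identityˡ _) (identityʳ _))

  structural-left-inverse : ∀ {A B} {x : Hom A B} {c : Hom B A} → {{Structural c}} → x ⨾ c ≡ id → Structural x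
  structural-left-inverse {{p , refl}} h = sym p , inverse-unique h (coe-inverseʳ p)

  σ-hexagon-α : ∀ {X Y Z} → σ {X} {Y ⊗₀ Z} ≡ α⇐ ⨾ (σ ⊗₁ id) ⨾ α⇒ ⨾ (id ⊗₁ σ) ⨾ α⇐
  σ-hexagon-α {X} {Y} {Z} = begin-equality
    σ
      ≡⟨ σ-hexagon ⟩
    cast (assoc₀ X Y Z) refl ((σ ⊗₁ id) ⨾ cast (sym (assoc₀ Y X Z)) (sym (assoc₀ Y Z X)) (id ⊗₁ σ))
      ≡⟨ trans (cast≡coe _ _ _) (cong (α⇐ ⨾_) (identityʳ _)) ⟩
    α⇐ ⨾ (σ ⊗₁ id) ⨾ cast (sym (assoc₀ Y X Z)) (sym (assoc₀ Y Z X)) (id ⊗₁ σ)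
      ≡⟨ cong (λ h → α⇐ ⨾ (σ ⊗₁ id) ⨾ h)
           (trans (cast≡coe _ _ _) (cong (_⨾ (id ⊗₁ σ) ⨾ α⇐) (coe-irrelevant (sym (sym (assoc₀ Y X Z))) (assoc₀ Y X Z)))) ⟩
    α⇐ ⨾ (σ ⊗₁ id) ⨾ α⇒ ⨾ (id ⊗₁ σ) ⨾ α⇐ ∎

  σ-unit-hexagon : ∀ {X} → σ {X} {I} ≡ σ ⨾ (ρ⇐ ⨾ α⇒ ⨾ λ⇒) ⨾ σ
  σ-unit-hexagon {X} =
    structural-cancelʳ {{structural-coe q₂}} (structural-cancelˡ {c = α⇐ ⨾ ρ⇒} (begin-equality
      (α⇐ ⨾ ρ⇒) ⨾ s ⨾ coe q₂
        ≡⟨ cong (_⨾ s ⨾ coe q₂) (coherence {{sg = structural-coe q₁}}) ⟩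
      coe q₁ ⨾ s ⨾ coe q₂
        ≡⟨ σ-transport (unitˡ₀ I) ⟨
      σ
        ≡⟨ σ-hexagon-α ⟩
      α⇐ ⨾ (s ⊗₁ id) ⨾ α⇒ ⨾ (id ⊗₁ s) ⨾ α⇐
        ≡⟨ cong₂ (λ a b → α⇐ ⨾ a ⨾ α⇒ ⨾ b ⨾ α⇐) (⊗idI-conjugate s) (idI⊗-conjugate s) ⟩
      α⇐ ⨾ (ρ⇒ ⨾ s ⨾ ρ⇐) ⨾ α⇒ ⨾ (λ⇒ ⨾ s ⨾ λ⇐) ⨾ α⇐
        ≡⟨ cong (α⇐ ⨾_) (trans (assoc₃ ρ⇒ s ρ⇐ _) (cong (λ h → ρ⇒ ⨾ s ⨾ ρ⇐ ⨾ α⇒ ⨾ h) (assoc₃ λ⇒ s λ⇐ α⇐))) ⟩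
      α⇐ ⨾ ρ⇒ ⨾ s ⨾ ρ⇐ ⨾ α⇒ ⨾ λ⇒ ⨾ s ⨾ λ⇐ ⨾ α⇐
        ≡⟨ trans (assoc α⇐ ρ⇒ _) (cong (λ h → α⇐ ⨾ ρ⇒ ⨾ s ⨾ h) (assoc₃ ρ⇐ α⇒ λ⇒ _)) ⟨
      (α⇐ ⨾ ρ⇒) ⨾ s ⨾ M ⨾ s ⨾ λ⇐ ⨾ α⇐
        ≡⟨ cong ((α⇐ ⨾ ρ⇒) ⨾_) (assoc₃ s M s _) ⟨
      (α⇐ ⨾ ρ⇒) ⨾ (s ⨾ M ⨾ s) ⨾ λ⇐ ⨾ α⇐
        ≡⟨ cong (λ h → (α⇐ ⨾ ρ⇒) ⨾ (s ⨾ M ⨾ s) ⨾ h) (coherence {{sg = structural-coe q₂}}) ⟩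
      (α⇐ ⨾ ρ⇒) ⨾ (s ⨾ M ⨾ s) ⨾ coe q₂ ∎))
    where
    s : Hom (X ⊗₀ I) (I ⊗₀ X)
    s = σ
    M : Hom (I ⊗₀ X) (X ⊗₀ I)
    M = ρ⇐ ⨾ α⇒ ⨾ λ⇒
    q₁ : X ⊗₀ (I ⊗₀ I) ≡ X ⊗₀ I
    q₁ = cong (X ⊗₀_) (unitˡ₀ I)
    q₂ : I ⊗₀ X ≡ (I ⊗₀ I) ⊗₀ X
    q₂ = cong (_⊗₀ X) (sym (unitˡ₀ I))

  -- Since σ is involutive, σ-unit-hexagon makes σ left inverse to the structural ρ⇐ ⨾ α⇒ ⨾ λ⇒.
  instance
    σ-unitʳ-structural : ∀ {X} → Structural (σ {X} {I})
    σ-unitʳ-structural {X} = structural-left-inverse {c = ρ⇐ ⨾ α⇒ ⨾ λ⇒} (begin-equality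
        s ⨾ M                ≡⟨ cancelʳ σ-involutive ⟨
        (s ⨾ M) ⨾ s ⨾ σ      ≡⟨ assoc s M (s ⨾ σ) ⟩
        s ⨾ M ⨾ s ⨾ σ        ≡⟨ assoc₃ s M s σ ⟨
        (s ⨾ M ⨾ s) ⨾ σ      ≡⟨ cong (_⨾ σ) σ-unit-hexagon ⟨
        s ⨾ σ                ≡⟨ σ-involutive ⟩
        id                   ∎)
      where
      s : Hom (X ⊗₀ I) (I ⊗₀ X)
      s = σ
      M : Hom (I ⊗₀ X) (X ⊗₀ I)
      M = ρ⇐ ⨾ α⇒ ⨾ λ⇒

  σ-unitˡ-structural : ∀ {X} → Structural (σ {I} {X})
  σ-unitˡ-structural = structural-left-inverse σ-involutive

  exchange : ∀ {A B D} → Hom (A ⊗₀ (B ⊗₀ D)) (B ⊗₀ (A ⊗₀ D))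
  exchange = α⇐ ⨾ (σ ⊗₁ id) ⨾ α⇒

  exchange-natural : ∀ {A B D A′ B′ D′} (f : Hom A A′) (g : Hom B B′) (h : Hom D D′) →
                     exchange ⨾ (g ⊗₁ (f ⊗₁ h)) ≡ (f ⊗₁ (g ⊗₁ h)) ⨾ exchange
  exchange-natural f g h = begin-equality
    (α⇐ ⨾ (σ ⊗₁ id) ⨾ α⇒) ⨾ (g ⊗₁ (f ⊗₁ h))
      ≡⟨ assoc₃ α⇐ (σ ⊗₁ id) α⇒ _ ⟩
    α⇐ ⨾ (σ ⊗₁ id) ⨾ α⇒ ⨾ (g ⊗₁ (f ⊗₁ h))
      ≡⟨ cong (λ k → α⇐ ⨾ (σ ⊗₁ id) ⨾ k) (α⇒-natural g f h) ⟨
    α⇐ ⨾ (σ ⊗₁ id) ⨾ ((g ⊗₁ f) ⊗₁ h) ⨾ α⇒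
      ≡⟨ cong (α⇐ ⨾_) (pullˡ (sym (⊗-⨾ σ (g ⊗₁ f) id h))) ⟩
    α⇐ ⨾ ((σ ⨾ (g ⊗₁ f)) ⊗₁ (id ⨾ h)) ⨾ α⇒
      ≡⟨ cong (λ k → α⇐ ⨾ k ⨾ α⇒) (cong₂ _⊗₁_ (sym (σ-natural f g)) (trans (identityˡ h) (sym (identityʳ h)))) ⟩
    α⇐ ⨾ (((f ⊗₁ g) ⨾ σ) ⊗₁ (h ⨾ id)) ⨾ α⇒
      ≡⟨ cong (α⇐ ⨾_) (trans (cong (_⨾ α⇒) (⊗-⨾ (f ⊗₁ g) σ h id)) (assoc _ _ _)) ⟩
    α⇐ ⨾ ((f ⊗₁ g) ⊗₁ h) ⨾ (σ ⊗₁ id) ⨾ α⇒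
      ≡⟨ extend (α⇐-natural f g h) ⟩
    (f ⊗₁ (g ⊗₁ h)) ⨾ α⇐ ⨾ (σ ⊗₁ id) ⨾ α⇒ ∎

  shuffle : ∀ {A A′ B B′} → Hom ((A ⊗₀ A′) ⊗₀ (B ⊗₀ B′)) ((A ⊗₀ B) ⊗₀ (A′ ⊗₀ B′))
  shuffle = α⇒ ⨾ (id ⊗₁ exchange) ⨾ α⇐

  shuffle-natural : ∀ {A A′ B B′ D D′ E E′} (f : Hom A D) (f′ : Hom A′ D′) (g : Hom B E) (g′ : Hom B′ E′) →
                    shuffle ⨾ ((f ⊗₁ g) ⊗₁ (f′ ⊗₁ g′)) ≡ ((f ⊗₁ f′) ⊗₁ (g ⊗₁ g′)) ⨾ shuffle
  shuffle-natural f f′ g g′ = begin-equality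
    (α⇒ ⨾ (id ⊗₁ exchange) ⨾ α⇐) ⨾ ((f ⊗₁ g) ⊗₁ (f′ ⊗₁ g′))
      ≡⟨ assoc₃ α⇒ (id ⊗₁ exchange) α⇐ _ ⟩
    α⇒ ⨾ (id ⊗₁ exchange) ⨾ α⇐ ⨾ ((f ⊗₁ g) ⊗₁ (f′ ⊗₁ g′))
      ≡⟨ cong (λ k → α⇒ ⨾ (id ⊗₁ exchange) ⨾ k) (α⇐-natural f g (f′ ⊗₁ g′)) ⟩
    α⇒ ⨾ (id ⊗₁ exchange) ⨾ (f ⊗₁ (g ⊗₁ (f′ ⊗₁ g′))) ⨾ α⇐
      ≡⟨ cong (α⇒ ⨾_) (pullˡ (id⊗⨾⊗ exchange f _)) ⟩
    α⇒ ⨾ (f ⊗₁ (exchange ⨾ (g ⊗₁ (f′ ⊗₁ g′)))) ⨾ α⇐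
      ≡⟨ cong (λ k → α⇒ ⨾ (f ⊗₁ k) ⨾ α⇐) (exchange-natural f′ g g′) ⟩
    α⇒ ⨾ (f ⊗₁ ((f′ ⊗₁ (g ⊗₁ g′)) ⨾ exchange)) ⨾ α⇐
      ≡⟨ cong (α⇒ ⨾_) (trans (cong (_⨾ α⇐) (sym (⊗⨾id⊗ f _ exchange))) (assoc _ _ _)) ⟩
    α⇒ ⨾ (f ⊗₁ (f′ ⊗₁ (g ⊗₁ g′))) ⨾ (id ⊗₁ exchange) ⨾ α⇐
      ≡⟨ extend (α⇒-natural f f′ (g ⊗₁ g′)) ⟨
    ((f ⊗₁ f′) ⊗₁ (g ⊗₁ g′)) ⨾ α⇒ ⨾ (id ⊗₁ exchange) ⨾ α⇐ ∎


module Comonoid {o ℓ e : Level} (C : CartesianBicategory o ℓ e) where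
  open CartesianBicategory C
  open HomReasoning C
  open Coherence C
  open ≤-Reasoning

  infix 4 _⊣_
  _⊣_ : ∀ {A B} → Hom A B → Hom B A → Set e
  l ⊣ r = (id ≤ l ⨾ r) × (r ⨾ l ≤ id)

  iso⇒⊣ : ∀ {A B} {f : Hom A B} {g : Hom B A} → f ⨾ g ≡ id → g ⨾ f ≡ id → f ⊣ g
  iso⇒⊣ fg gf = ≤-reflexive (sym fg) , ≤-reflexive gf

  ⊣-⨾ : ∀ {A B D} {l₁ : Hom A B} {r₁ : Hom B A} {l₂ : Hom B D} {r₂ : Hom D B} →
        l₁ ⊣ r₁ → l₂ ⊣ r₂ → l₁ ⨾ l₂ ⊣ r₂ ⨾ r₁
  ⊣-⨾ {l₁ = l₁} {r₁} {l₂} {r₂} (η₁ , ε₁) (η₂ , ε₂) =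
    (begin
      id                    ≤⟨ η₁ ⟩
      l₁ ⨾ r₁               ≡⟨ cong (l₁ ⨾_) (identityˡ r₁) ⟨
      l₁ ⨾ id ⨾ r₁          ≤⟨ ⨾-monoʳ l₁ (⨾-monoˡ r₁ η₂) ⟩
      l₁ ⨾ (l₂ ⨾ r₂) ⨾ r₁   ≡⟨ trans (cong (l₁ ⨾_) (assoc l₂ r₂ r₁)) (sym (assoc l₁ l₂ (r₂ ⨾ r₁))) ⟩
      (l₁ ⨾ l₂) ⨾ r₂ ⨾ r₁   ∎) ,
    (begin
      (r₂ ⨾ r₁) ⨾ l₁ ⨾ l₂   ≡⟨ trans (assoc r₂ r₁ (l₁ ⨾ l₂)) (cong (r₂ ⨾_) (sym (assoc r₁ l₁ l₂))) ⟩
      r₂ ⨾ (r₁ ⨾ l₁) ⨾ l₂   ≤⟨ ⨾-monoʳ r₂ (⨾-monoˡ l₂ ε₁) ⟩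
      r₂ ⨾ id ⨾ l₂          ≡⟨ cong (r₂ ⨾_) (identityˡ l₂) ⟩
      r₂ ⨾ l₂               ≤⟨ ε₂ ⟩
      id                    ∎)

  ⊣-⊗ : ∀ {A B A′ B′} {l₁ : Hom A B} {r₁ : Hom B A} {l₂ : Hom A′ B′} {r₂ : Hom B′ A′} →
        l₁ ⊣ r₁ → l₂ ⊣ r₂ → l₁ ⊗₁ l₂ ⊣ r₁ ⊗₁ r₂
  ⊣-⊗ {l₁ = l₁} {r₁} {l₂} {r₂} (η₁ , ε₁) (η₂ , ε₂) =
    (begin
      id                            ≡⟨ ⊗-id ⟨
      id ⊗₁ id                      ≤⟨ ⊗-mono η₁ η₂ ⟩
      (l₁ ⨾ r₁) ⊗₁ (l₂ ⨾ r₂)        ≡⟨ ⊗-⨾ l₁ r₁ l₂ r₂ ⟩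
      (l₁ ⊗₁ l₂) ⨾ (r₁ ⊗₁ r₂)       ∎) ,
    (begin
      (r₁ ⊗₁ r₂) ⨾ (l₁ ⊗₁ l₂)       ≡⟨ ⊗-⨾ r₁ l₁ r₂ l₂ ⟨
      (r₁ ⨾ l₁) ⊗₁ (r₂ ⨾ l₂)        ≤⟨ ⊗-mono ε₁ ε₂ ⟩
      id ⊗₁ id                      ≡⟨ ⊗-id ⟩
      id                            ∎)

  ⊣-unique : ∀ {A B} {l : Hom A B} {r r′ : Hom B A} → l ⊣ r → l ⊣ r′ → r ≤ r′
  ⊣-unique {l = l} {r} {r′} (_ , ε) (η′ , _) = begin
    r                ≡⟨ identityʳ r ⟨
    r ⨾ id           ≤⟨ ⨾-monoʳ r η′ ⟩
    r ⨾ l ⨾ r′       ≡⟨ assoc r l r′ ⟨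
    (r ⨾ l) ⨾ r′     ≤⟨ ⨾-monoˡ r′ ε ⟩
    id ⨾ r′          ≡⟨ identityˡ r′ ⟩
    r′               ∎

  right-adjoint-unique : ∀ {A B} {l : Hom A B} {r r′ : Hom B A} → l ⊣ r → l ⊣ r′ → r ≡ r′
  right-adjoint-unique l⊣r l⊣r′ = ≤-antisym (⊣-unique l⊣r l⊣r′) (⊣-unique l⊣r′ l⊣r)

  δ⊣δ* : ∀ {X} → δ {X} ⊣ δ*
  δ⊣δ* = δ-unit , δ-counit

  ε⊣ε* : ∀ {X} → ε {X} ⊣ ε*
  ε⊣ε* = ε-unit , ε-counit

  δ⨾id⊗ε : ∀ {X} → δ {X} ⨾ (id ⊗₁ ε) ≡ ρ⇐
  δ⨾id⊗ε {X} = inverse-unique (trans (sym (identityˡ _)) (trans (sym (cast≡coe refl (unitʳ₀ X) _)) δ-counitʳ)) ρ⇒⨾ρ⇐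

  δ⨾ε⊗id : ∀ {X} → δ {X} ⨾ (ε ⊗₁ id) ≡ λ⇐
  δ⨾ε⊗id {X} = inverse-unique (trans (sym (identityˡ _)) (trans (sym (cast≡coe refl (unitˡ₀ X) _)) δ-counitˡ)) λ⇒⨾λ⇐

  δ⨾ε⊗ : ∀ {X Y} (f : Hom X Y) → δ ⨾ (ε ⊗₁ f) ≡ f ⨾ λ⇐
  δ⨾ε⊗ f = begin-equality
    δ ⨾ (ε ⊗₁ f)               ≡⟨ cong (δ ⨾_) (⊗id⨾id⊗ ε f) ⟨
    δ ⨾ (ε ⊗₁ id) ⨾ (id ⊗₁ f)  ≡⟨ pullˡ δ⨾ε⊗id ⟩
    λ⇐ ⨾ (id ⊗₁ f)             ≡⟨ λ⇐-natural f ⟩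
    f ⨾ λ⇐                     ∎

  δ⨾ε⊗id⨾λ⇒ : ∀ {X} → δ {X} ⨾ (ε ⊗₁ id) ⨾ λ⇒ ≡ id
  δ⨾ε⊗id⨾λ⇒ = trans (pullˡ δ⨾ε⊗id) λ⇐⨾λ⇒

  -- δ* is a multiplication with unit ε*: the right adjoints of both sides of the counit law agree.
  ρ⇐⨾id⊗ε*⨾δ* : ∀ {X} → ρ⇐ ⨾ (id ⊗₁ ε*) ⨾ δ* ≡ id {X}
  ρ⇐⨾id⊗ε*⨾δ* = trans (cong (ρ⇐ ⨾_) id⊗ε*⨾δ*) ρ⇐⨾ρ⇒
    where
    id⊗ε*⨾δ* : (id ⊗₁ ε*) ⨾ δ* ≡ ρ⇒
    id⊗ε*⨾δ* = right-adjoint-unique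
      (subst (_⊣ _) δ⨾id⊗ε (⊣-⨾ δ⊣δ* (⊣-⊗ (iso⇒⊣ (identityˡ id) (identityˡ id)) ε⊣ε*)))
      (iso⇒⊣ ρ⇐⨾ρ⇒ ρ⇒⨾ρ⇐)

  σ⨾δ* : ∀ {X} → σ ⨾ δ* ≡ δ* {X}
  σ⨾δ* = right-adjoint-unique (subst (_⊣ _) δ-cocomm (⊣-⨾ δ⊣δ* (iso⇒⊣ σ-involutive σ-involutive))) δ⊣δ*

  -- Primed laws restate axioms of the record with the transports replaced by α, λ and ρ.
  δ-coassoc′ : ∀ {X} → δ {X} ⨾ (δ ⊗₁ id) ≡ δ ⨾ (id ⊗₁ δ) ⨾ α⇐
  δ-coassoc′ {X} = begin-equality
    δ ⨾ (δ ⊗₁ id)                ≡⟨ cancelʳ α⇒⨾α⇐ ⟨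
    (δ ⨾ (δ ⊗₁ id)) ⨾ α⇒ ⨾ α⇐    ≡⟨ pullˡ (trans (cast-square refl (assoc₀ X X X) δ-coassoc) (identityˡ _)) ⟩
    (δ ⨾ (id ⊗₁ δ)) ⨾ α⇐         ≡⟨ assoc δ (id ⊗₁ δ) α⇐ ⟩
    δ ⨾ (id ⊗₁ δ) ⨾ α⇐           ∎

  frobenius′ : ∀ {X} → (id ⊗₁ δ) ⨾ α⇐ ⨾ (δ* ⊗₁ id) ≡ δ* {X} ⨾ δ
  frobenius′ = sym (trans frobenius (cong ((id ⊗₁ δ) ⨾_) (trans (cast≡coe _ _ _) (cong (α⇐ ⨾_) (identityʳ _)))))

  δ-⊗′ : ∀ {X Y} → δ {X ⊗₀ Y} ≡ (δ ⊗₁ δ) ⨾ shuffle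
  δ-⊗′ {X} {Y} = trans δ-⊗ (cong ((δ ⊗₁ δ) ⨾_) (begin-equality
    cast P Q (id ⊗₁ (σ ⊗₁ id))
      ≡⟨ cast≡coe P Q _ ⟩
    coe (sym P) ⨾ (id ⊗₁ (σ ⊗₁ id)) ⨾ coe Q
      ≡⟨ cong₂ (λ a b → a ⨾ (id ⊗₁ (σ ⊗₁ id)) ⨾ b)
           (coherence {{sf = structural-coe (sym P)}})
           (coherence {{sf = structural-coe Q}}) ⟩
    (α⇒ ⨾ (id ⊗₁ α⇐)) ⨾ (id ⊗₁ (σ ⊗₁ id)) ⨾ (id ⊗₁ α⇒) ⨾ α⇐
      ≡⟨ trans (assoc _ _ _) (cong (α⇒ ⨾_) (trans (pullˡ (sym (id⊗-⨾ α⇐ _))) (pullˡ (sym (id⊗-⨾ _ α⇒))))) ⟩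
    α⇒ ⨾ (id ⊗₁ ((α⇐ ⨾ (σ ⊗₁ id)) ⨾ α⇒)) ⨾ α⇐
      ≡⟨ cong (λ h → α⇒ ⨾ (id ⊗₁ h) ⨾ α⇐) (assoc _ _ _) ⟩
    shuffle ∎))
    where
    P : X ⊗₀ ((X ⊗₀ Y) ⊗₀ Y) ≡ (X ⊗₀ X) ⊗₀ (Y ⊗₀ Y)
    P = sym (trans (assoc₀ X X (Y ⊗₀ Y)) (cong (X ⊗₀_) (sym (assoc₀ X Y Y))))
    Q : X ⊗₀ ((Y ⊗₀ X) ⊗₀ Y) ≡ (X ⊗₀ Y) ⊗₀ (X ⊗₀ Y)
    Q = trans (cong (X ⊗₀_) (assoc₀ Y X Y)) (sym (assoc₀ X Y (X ⊗₀ Y)))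

  ε-⊗′ : ∀ {X Y} → ε {X ⊗₀ Y} ≡ (ε ⊗₁ ε) ⨾ λ⇒
  ε-⊗′ = trans ε-⊗ (trans (cast≡coe _ _ _) (identityˡ _))

  mate : ∀ {A B A′ B′} {l : Hom A B} {r : Hom B A} {l′ : Hom A′ B′} {r′ : Hom B′ A′} {f : Hom A A′} {g : Hom B B′} →
         l ⊣ r → l′ ⊣ r′ → f ⨾ l′ ≤ l ⨾ g → r ⨾ f ≤ g ⨾ r′
  mate {l = l} {r} {l′} {r′} {f} {g} (_ , counit) (unit′ , _) square = begin
    r ⨾ f                ≡⟨ identityʳ _ ⟨
    (r ⨾ f) ⨾ id         ≤⟨ ⨾-monoʳ _ unit′ ⟩
    (r ⨾ f) ⨾ l′ ⨾ r′    ≡⟨ trans (assoc _ _ _) (cong (r ⨾_) (sym (assoc _ _ _))) ⟩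
    r ⨾ (f ⨾ l′) ⨾ r′    ≤⟨ ⨾-monoʳ r (⨾-monoˡ r′ square) ⟩
    r ⨾ (l ⨾ g) ⨾ r′     ≡⟨ trans (cong (r ⨾_) (assoc _ _ _)) (sym (assoc _ _ _)) ⟩
    (r ⨾ l) ⨾ g ⨾ r′     ≤⟨ ⨾-monoˡ _ counit ⟩
    id ⨾ g ⨾ r′          ≡⟨ identityˡ _ ⟩
    g ⨾ r′               ∎

  ε*-lax : ∀ {X Y} (f : Hom X Y) → ε* ⨾ f ≤ ε*
  ε*-lax f = ≤-trans (mate ε⊣ε* ε⊣ε* (≤-trans (ε-lax f) (≤-reflexive (sym (identityʳ ε))))) (≤-reflexive (identityˡ ε*))

  δ*-lax : ∀ {X Y} (f : Hom X Y) → δ* ⨾ f ≤ (f ⊗₁ f) ⨾ δ*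
  δ*-lax f = mate δ⊣δ* δ⊣δ* (δ-lax f)


module Relations {o ℓ e : Level} (C : CartesianBicategory o ℓ e) where
  open CartesianBicategory C
  open HomReasoning C
  open Coherence C
  open Comonoid C
  open ≤-Reasoning

  cup : ∀ {X} → Hom I (X ⊗₀ X)
  cup = ε* ⨾ δ

  cap : ∀ {X} → Hom (X ⊗₀ X) I
  cap = δ* ⨾ ε

  σ⨾cap : ∀ {X} → σ ⨾ cap ≡ cap {X}
  σ⨾cap = trans (sym (assoc _ _ _)) (cong (_⨾ ε) σ⨾δ*)

  -- bend N K plugs the A-output of N into the A-input of K.
  bend : ∀ {Y A B} → Hom I (A ⊗₀ B) → Hom (Y ⊗₀ A) I → Hom Y B
  bend N K = ρ⇐ ⨾ (id ⊗₁ N) ⨾ α⇐ ⨾ (K ⊗₁ id) ⨾ λ⇒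

  snake : ∀ {X} → bend cup cap ≡ id {X}
  snake = begin-equality
    ρ⇐ ⨾ (id ⊗₁ (ε* ⨾ δ)) ⨾ α⇐ ⨾ ((δ* ⨾ ε) ⊗₁ id) ⨾ λ⇒
      ≡⟨ cong (ρ⇐ ⨾_) (pushˡ (id⊗-⨾ ε* δ)) ⟩
    ρ⇐ ⨾ (id ⊗₁ ε*) ⨾ (id ⊗₁ δ) ⨾ α⇐ ⨾ ((δ* ⨾ ε) ⊗₁ id) ⨾ λ⇒
      ≡⟨ cong (λ h → ρ⇐ ⨾ (id ⊗₁ ε*) ⨾ (id ⊗₁ δ) ⨾ α⇐ ⨾ h) (pushˡ (⨾-⊗id δ* ε)) ⟩
    ρ⇐ ⨾ (id ⊗₁ ε*) ⨾ (id ⊗₁ δ) ⨾ α⇐ ⨾ (δ* ⊗₁ id) ⨾ (ε ⊗₁ id) ⨾ λ⇒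
      ≡⟨ cong (λ h → ρ⇐ ⨾ (id ⊗₁ ε*) ⨾ h) (trans (pull₃ˡ frobenius′) (assoc _ _ _)) ⟩
    ρ⇐ ⨾ (id ⊗₁ ε*) ⨾ δ* ⨾ δ ⨾ (ε ⊗₁ id) ⨾ λ⇒
      ≡⟨ trans (pull₃ˡ ρ⇐⨾id⊗ε*⨾δ*) (identityˡ _) ⟩
    δ ⨾ (ε ⊗₁ id) ⨾ λ⇒
      ≡⟨ δ⨾ε⊗id⨾λ⇒ ⟩
    id ∎

  bend-⨾ˡ : ∀ {Y′ Y A B} (f : Hom Y′ Y) (N : Hom I (A ⊗₀ B)) (K : Hom (Y ⊗₀ A) I) →
            f ⨾ bend N K ≡ bend N ((f ⊗₁ id) ⨾ K)
  bend-⨾ˡ f N K = begin-equality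
    f ⨾ ρ⇐ ⨾ (id ⊗₁ N) ⨾ α⇐ ⨾ (K ⊗₁ id) ⨾ λ⇒
      ≡⟨ extend (ρ⇐-natural f) ⟨
    ρ⇐ ⨾ (f ⊗₁ id) ⨾ (id ⊗₁ N) ⨾ α⇐ ⨾ (K ⊗₁ id) ⨾ λ⇒
      ≡⟨ cong (ρ⇐ ⨾_) (trans (pullˡ (⊗-slide f N)) (assoc _ _ _)) ⟩
    ρ⇐ ⨾ (id ⊗₁ N) ⨾ (f ⊗₁ id) ⨾ α⇐ ⨾ (K ⊗₁ id) ⨾ λ⇒
      ≡⟨ cong (λ h → ρ⇐ ⨾ (id ⊗₁ N) ⨾ h) (pullˡ (trans (cong (λ w → (f ⊗₁ w) ⨾ α⇐) (sym ⊗-id)) (sym (α⇐-natural f id id)))) ⟩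
    ρ⇐ ⨾ (id ⊗₁ N) ⨾ (α⇐ ⨾ ((f ⊗₁ id) ⊗₁ id)) ⨾ (K ⊗₁ id) ⨾ λ⇒
      ≡⟨ cong (λ h → ρ⇐ ⨾ (id ⊗₁ N) ⨾ h) (trans (assoc _ _ _) (cong (α⇐ ⨾_) (pullˡ (sym (⨾-⊗id _ _))))) ⟩
    ρ⇐ ⨾ (id ⊗₁ N) ⨾ α⇐ ⨾ (((f ⊗₁ id) ⨾ K) ⊗₁ id) ⨾ λ⇒ ∎

  bend-⨾ʳ : ∀ {Y A B B′} (N : Hom I (A ⊗₀ B)) (K : Hom (Y ⊗₀ A) I) (g : Hom B B′) →
            bend N K ⨾ g ≡ bend (N ⨾ (id ⊗₁ g)) K
  bend-⨾ʳ N K g = begin-equality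
    (ρ⇐ ⨾ (id ⊗₁ N) ⨾ α⇐ ⨾ (K ⊗₁ id) ⨾ λ⇒) ⨾ g
      ≡⟨ trans (assoc₃ ρ⇐ (id ⊗₁ N) _ g) (cong (λ h → ρ⇐ ⨾ (id ⊗₁ N) ⨾ h) (assoc₃ α⇐ (K ⊗₁ id) λ⇒ g)) ⟩
    ρ⇐ ⨾ (id ⊗₁ N) ⨾ α⇐ ⨾ (K ⊗₁ id) ⨾ λ⇒ ⨾ g
      ≡⟨ cong (λ h → ρ⇐ ⨾ (id ⊗₁ N) ⨾ α⇐ ⨾ (K ⊗₁ id) ⨾ h) (λ⇒-natural g) ⟨
    ρ⇐ ⨾ (id ⊗₁ N) ⨾ α⇐ ⨾ (K ⊗₁ id) ⨾ (id ⊗₁ g) ⨾ λ⇒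
      ≡⟨ cong (λ h → ρ⇐ ⨾ (id ⊗₁ N) ⨾ α⇐ ⨾ h) (extend (⊗-slide K g)) ⟩
    ρ⇐ ⨾ (id ⊗₁ N) ⨾ α⇐ ⨾ (id ⊗₁ g) ⨾ (K ⊗₁ id) ⨾ λ⇒
      ≡⟨ cong (λ h → ρ⇐ ⨾ (id ⊗₁ N) ⨾ h) (extend (trans (cong (λ w → α⇐ ⨾ (w ⊗₁ g)) (sym ⊗-id)) (α⇐-natural id id g))) ⟩
    ρ⇐ ⨾ (id ⊗₁ N) ⨾ (id ⊗₁ (id ⊗₁ g)) ⨾ α⇐ ⨾ (K ⊗₁ id) ⨾ λ⇒
      ≡⟨ cong (ρ⇐ ⨾_) (pullˡ (sym (id⊗-⨾ N (id ⊗₁ g)))) ⟩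
    ρ⇐ ⨾ (id ⊗₁ (N ⨾ (id ⊗₁ g))) ⨾ α⇐ ⨾ (K ⊗₁ id) ⨾ λ⇒ ∎

  bend-slide : ∀ {Y A A′ B} (N : Hom I (A ⊗₀ B)) (g : Hom A A′) (K : Hom (Y ⊗₀ A′) I) →
               bend (N ⨾ (g ⊗₁ id)) K ≡ bend N ((id ⊗₁ g) ⨾ K)
  bend-slide N g K = begin-equality
    ρ⇐ ⨾ (id ⊗₁ (N ⨾ (g ⊗₁ id))) ⨾ α⇐ ⨾ (K ⊗₁ id) ⨾ λ⇒
      ≡⟨ cong (ρ⇐ ⨾_) (pushˡ (id⊗-⨾ N (g ⊗₁ id))) ⟩
    ρ⇐ ⨾ (id ⊗₁ N) ⨾ (id ⊗₁ (g ⊗₁ id)) ⨾ α⇐ ⨾ (K ⊗₁ id) ⨾ λ⇒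
      ≡⟨ cong (λ h → ρ⇐ ⨾ (id ⊗₁ N) ⨾ h) (pullˡ (sym (α⇐-natural id g id))) ⟩
    ρ⇐ ⨾ (id ⊗₁ N) ⨾ (α⇐ ⨾ ((id ⊗₁ g) ⊗₁ id)) ⨾ (K ⊗₁ id) ⨾ λ⇒
      ≡⟨ cong (λ h → ρ⇐ ⨾ (id ⊗₁ N) ⨾ h) (trans (assoc _ _ _) (cong (α⇐ ⨾_) (pullˡ (sym (⨾-⊗id _ _))))) ⟩
    ρ⇐ ⨾ (id ⊗₁ N) ⨾ α⇐ ⨾ (((id ⊗₁ g) ⨾ K) ⊗₁ id) ⨾ λ⇒ ∎

  bend-mono : ∀ {Y A B} {N N′ : Hom I (A ⊗₀ B)} {K K′ : Hom (Y ⊗₀ A) I} → N ≤ N′ → K ≤ K′ → bend N K ≤ bend N′ K′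
  bend-mono N≤N′ K≤K′ =
    ⨾-monoʳ ρ⇐ (⨾-mono (⊗-monoʳ id N≤N′) (⨾-monoʳ α⇐ (⨾-monoˡ λ⇒ (⊗-monoˡ id K≤K′))))

  bend-point : ∀ {Y A} (s : Hom I A) (K : Hom (Y ⊗₀ A) I) → bend (s ⨾ ρ⇐) K ≡ ρ⇐ ⨾ (id ⊗₁ s) ⨾ K
  bend-point s K = begin-equality
    ρ⇐ ⨾ (id ⊗₁ (s ⨾ ρ⇐)) ⨾ α⇐ ⨾ (K ⊗₁ id) ⨾ λ⇒
      ≡⟨ cong (ρ⇐ ⨾_) (pushˡ (id⊗-⨾ s ρ⇐)) ⟩
    ρ⇐ ⨾ (id ⊗₁ s) ⨾ (id ⊗₁ ρ⇐) ⨾ α⇐ ⨾ (K ⊗₁ id) ⨾ λ⇒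
      ≡⟨ cong (λ h → ρ⇐ ⨾ (id ⊗₁ s) ⨾ h) (pullˡ coherence) ⟩
    ρ⇐ ⨾ (id ⊗₁ s) ⨾ ρ⇐ ⨾ (K ⊗₁ id) ⨾ λ⇒
      ≡⟨ cong (λ h → ρ⇐ ⨾ (id ⊗₁ s) ⨾ h) (trans (extend (ρ⇐-natural K)) (cong (K ⨾_) coherence)) ⟩
    ρ⇐ ⨾ (id ⊗₁ s) ⨾ K ⨾ id
      ≡⟨ cong (λ h → ρ⇐ ⨾ (id ⊗₁ s) ⨾ h) (identityʳ K) ⟩
    ρ⇐ ⨾ (id ⊗₁ s) ⨾ K ∎

  _° : ∀ {X Y} → Hom X Y → Hom Y X
  R ° = _ᵒᵖ C R

  °≡bend : ∀ {X Y} (R : Hom X Y) → R ° ≡ bend (cup ⨾ (R ⊗₁ id)) cap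
  °≡bend {X} {Y} R = begin-equality
    cast (unitʳ₀ Y) refl (id ⊗₁ cup) ⨾ (id ⊗₁ (R ⊗₁ id)) ⨾ cast (assoc₀ Y Y X) (unitˡ₀ X) (cap ⊗₁ id)
      ≡⟨ cong₂ (λ a b → a ⨾ (id ⊗₁ (R ⊗₁ id)) ⨾ b) (trans (cast≡coe _ _ _) (cong (ρ⇐ ⨾_) (identityʳ _))) (cast≡coe _ _ _) ⟩
    (ρ⇐ ⨾ (id ⊗₁ cup)) ⨾ (id ⊗₁ (R ⊗₁ id)) ⨾ α⇐ ⨾ (cap ⊗₁ id) ⨾ λ⇒
      ≡⟨ trans (assoc _ _ _) (cong (ρ⇐ ⨾_) (pullˡ (sym (id⊗-⨾ _ _)))) ⟩
    bend (cup ⨾ (R ⊗₁ id)) cap ∎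

  °-mono : ∀ {X Y} {R S : Hom X Y} → R ≤ S → R ° ≤ S °
  °-mono {R = R} {S} R≤S = begin
    R °                            ≡⟨ °≡bend R ⟩
    bend (cup ⨾ (R ⊗₁ id)) cap     ≤⟨ bend-mono (⨾-monoʳ cup (⊗-monoˡ id R≤S)) ≤-refl ⟩
    bend (cup ⨾ (S ⊗₁ id)) cap     ≡⟨ °≡bend S ⟨
    S °                            ∎

  id° : ∀ {X} → id {X} ° ≡ id
  id° = begin-equality
    id °                             ≡⟨ °≡bend id ⟩
    bend (cup ⨾ (id ⊗₁ id)) cap      ≡⟨ cong (λ N → bend N cap) (trans (cong (cup ⨾_) ⊗-id) (identityʳ cup)) ⟩
    bend cup cap                     ≡⟨ snake ⟩
    id                               ∎

  cap-total : ∀ {X Y} (f : Hom X Y) → Total C f → cap ≤ (f ⊗₁ f) ⨾ cap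
  cap-total f total = begin
    δ* ⨾ ε                 ≤⟨ ⨾-monoʳ δ* total ⟩
    δ* ⨾ f ⨾ ε             ≡⟨ assoc _ _ _ ⟨
    (δ* ⨾ f) ⨾ ε           ≤⟨ ⨾-monoˡ ε (δ*-lax f) ⟩
    ((f ⊗₁ f) ⨾ δ*) ⨾ ε    ≡⟨ assoc _ _ _ ⟩
    (f ⊗₁ f) ⨾ δ* ⨾ ε      ∎

  cup-singleValued : ∀ {X Y} (f : Hom X Y) → SingleValued C f → cup ⨾ (f ⊗₁ f) ≤ cup
  cup-singleValued f singleValued = begin
    (ε* ⨾ δ) ⨾ (f ⊗₁ f)    ≡⟨ assoc _ _ _ ⟩
    ε* ⨾ δ ⨾ (f ⊗₁ f)      ≤⟨ ⨾-monoʳ ε* singleValued ⟩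
    ε* ⨾ f ⨾ δ             ≡⟨ assoc _ _ _ ⟨
    (ε* ⨾ f) ⨾ δ           ≤⟨ ⨾-monoˡ δ (ε*-lax f) ⟩
    ε* ⨾ δ                 ∎

  total⇒id≤⨾° : ∀ {X Y} (f : Hom X Y) → Total C f → id ≤ f ⨾ f °
  total⇒id≤⨾° f total = begin
    id                                         ≡⟨ snake ⟨
    bend cup cap                               ≤⟨ bend-mono ≤-refl (cap-total f total) ⟩
    bend cup ((f ⊗₁ f) ⨾ cap)                  ≡⟨ cong (bend cup) (pushˡ (sym (⊗id⨾id⊗ f f))) ⟩
    bend cup ((f ⊗₁ id) ⨾ (id ⊗₁ f) ⨾ cap)     ≡⟨ bend-⨾ˡ f cup _ ⟨
    f ⨾ bend cup ((id ⊗₁ f) ⨾ cap)             ≡⟨ cong (f ⨾_) (trans (°≡bend f) (bend-slide cup f cap)) ⟨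
    f ⨾ f °                                    ∎

  singleValued⇒°⨾≤id : ∀ {X Y} (f : Hom X Y) → SingleValued C f → f ° ⨾ f ≤ id
  singleValued⇒°⨾≤id f singleValued = begin
    f ° ⨾ f                                  ≡⟨ cong (_⨾ f) (°≡bend f) ⟩
    bend (cup ⨾ (f ⊗₁ id)) cap ⨾ f           ≡⟨ bend-⨾ʳ _ cap f ⟩
    bend ((cup ⨾ (f ⊗₁ id)) ⨾ (id ⊗₁ f)) cap ≡⟨ cong (λ N → bend N cap) (trans (assoc _ _ _) (cong (cup ⨾_) (⊗id⨾id⊗ f f))) ⟩
    bend (cup ⨾ (f ⊗₁ f)) cap                ≤⟨ bend-mono (cup-singleValued f singleValued) ≤-refl ⟩
    bend cup cap                             ≡⟨ snake ⟩
    id                                       ∎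

  map-⨾ : ∀ {X Y Z} {f : Hom X Y} {g : Hom Y Z} → IsMap C f → IsMap C g → IsMap C (f ⨾ g)
  map-⨾ {f = f} {g} (f-sv , f-total) (g-sv , g-total) =
    (begin
      δ ⨾ ((f ⨾ g) ⊗₁ (f ⨾ g))     ≡⟨ trans (cong (δ ⨾_) (⊗-⨾ f g f g)) (sym (assoc _ _ _)) ⟩
      (δ ⨾ (f ⊗₁ f)) ⨾ (g ⊗₁ g)    ≤⟨ ⨾-monoˡ _ f-sv ⟩
      (f ⨾ δ) ⨾ (g ⊗₁ g)           ≡⟨ assoc _ _ _ ⟩
      f ⨾ δ ⨾ (g ⊗₁ g)             ≤⟨ ⨾-monoʳ f g-sv ⟩
      f ⨾ g ⨾ δ                    ≡⟨ assoc _ _ _ ⟨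
      (f ⨾ g) ⨾ δ                  ∎) ,
    (begin
      ε                            ≤⟨ f-total ⟩
      f ⨾ ε                        ≤⟨ ⨾-monoʳ f g-total ⟩
      f ⨾ g ⨾ ε                    ≡⟨ assoc _ _ _ ⟨
      (f ⨾ g) ⨾ ε                  ∎)

  map≤id⇒≡id : ∀ {X} {m : Hom X X} → IsMap C m → m ≤ id → m ≡ id
  map≤id⇒≡id {m = m} (_ , total) m≤id = ≤-antisym m≤id (begin
    id            ≤⟨ total⇒id≤⨾° m total ⟩
    m ⨾ m °       ≤⟨ ⨾-monoʳ m (°-mono m≤id) ⟩
    m ⨾ id °      ≡⟨ trans (cong (m ⨾_) id°) (identityʳ m) ⟩
    m             ∎)


module Points {o ℓ e : Level} (C : CartesianBicategory o ℓ e) where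
  open CartesianBicategory C
  open HomReasoning C
  open Coherence C
  open Comonoid C
  open Relations C
  open ≤-Reasoning

  -- For a subset s : I → X, member s : X → I is the predicate of lying in s.
  member : ∀ {X} → Hom I X → Hom X I
  member s = ρ⇐ ⨾ (id ⊗₁ s) ⨾ cap

  member-swap : ∀ {X} (s : Hom I X) → member s ≡ λ⇐ ⨾ (s ⊗₁ id) ⨾ cap
  member-swap s = begin-equality
    ρ⇐ ⨾ (id ⊗₁ s) ⨾ cap          ≡⟨ cong (λ h → ρ⇐ ⨾ (id ⊗₁ s) ⨾ h) σ⨾cap ⟨
    ρ⇐ ⨾ (id ⊗₁ s) ⨾ σ ⨾ cap      ≡⟨ cong (ρ⇐ ⨾_) (extend (σ-natural id s)) ⟩
    ρ⇐ ⨾ σ ⨾ (s ⊗₁ id) ⨾ cap      ≡⟨ pullˡ coherence ⟩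
    λ⇐ ⨾ (s ⊗₁ id) ⨾ cap          ∎

  bend-cup : ∀ {X} (K : Hom (I ⊗₀ X) I) → bend cup K ≡ cup ⨾ ((λ⇐ ⨾ K) ⊗₁ id) ⨾ λ⇒
  bend-cup K = begin-equality
    ρ⇐ ⨾ (id ⊗₁ cup) ⨾ α⇐ ⨾ (K ⊗₁ id) ⨾ λ⇒
      ≡⟨ extend (trans (cong (_⨾ (id ⊗₁ cup)) coherence) (λ⇐-natural cup)) ⟩
    cup ⨾ λ⇐ ⨾ α⇐ ⨾ (K ⊗₁ id) ⨾ λ⇒
      ≡⟨ cong (cup ⨾_) (pullˡ coherence) ⟩
    cup ⨾ (λ⇐ ⊗₁ id) ⨾ (K ⊗₁ id) ⨾ λ⇒
      ≡⟨ cong (cup ⨾_) (pullˡ (sym (⨾-⊗id λ⇐ K))) ⟩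
    cup ⨾ ((λ⇐ ⨾ K) ⊗₁ id) ⨾ λ⇒ ∎

  cup⨾member⊗id : ∀ {X} (s : Hom I X) → cup ⨾ (member s ⊗₁ id) ⨾ λ⇒ ≡ s
  cup⨾member⊗id s = begin-equality
    cup ⨾ (member s ⊗₁ id) ⨾ λ⇒                       ≡⟨ cong (λ h → cup ⨾ (h ⊗₁ id) ⨾ λ⇒) (member-swap s) ⟩
    cup ⨾ ((λ⇐ ⨾ (s ⊗₁ id) ⨾ cap) ⊗₁ id) ⨾ λ⇒         ≡⟨ bend-cup _ ⟨
    bend cup ((s ⊗₁ id) ⨾ cap)                         ≡⟨ bend-⨾ˡ s cup cap ⟨
    s ⨾ bend cup cap                                   ≡⟨ trans (cong (s ⨾_) snake) (identityʳ s) ⟩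
    s                                                  ∎

  ε*≡cup⨾ε⊗id⨾λ⇒ : ∀ {X} → ε* {X} ≡ cup ⨾ (ε ⊗₁ id) ⨾ λ⇒
  ε*≡cup⨾ε⊗id⨾λ⇒ = begin-equality
    ε*                           ≡⟨ identityʳ ε* ⟨
    ε* ⨾ id                      ≡⟨ cong (ε* ⨾_) δ⨾ε⊗id⨾λ⇒ ⟨
    ε* ⨾ δ ⨾ (ε ⊗₁ id) ⨾ λ⇒      ≡⟨ assoc _ _ _ ⟨
    cup ⨾ (ε ⊗₁ id) ⨾ λ⇒         ∎

  member-total⇒ε*≤ : ∀ {X} (s : Hom I X) → ε ≤ member s → ε* ≤ s
  member-total⇒ε*≤ s ε≤ = begin
    ε*                              ≡⟨ ε*≡cup⨾ε⊗id⨾λ⇒ ⟩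
    cup ⨾ (ε ⊗₁ id) ⨾ λ⇒            ≤⟨ ⨾-monoʳ cup (⨾-monoˡ λ⇒ (⊗-monoˡ id ε≤)) ⟩
    cup ⨾ (member s ⊗₁ id) ⨾ λ⇒     ≡⟨ cup⨾member⊗id s ⟩
    s                               ∎

  ε≡member-ε* : ∀ {X} → ε {X} ≡ member ε*
  ε≡member-ε* = begin-equality
    ε                                ≡⟨ identityˡ ε ⟨
    id ⨾ ε                           ≡⟨ cong (_⨾ ε) ρ⇐⨾id⊗ε*⨾δ* ⟨
    (ρ⇐ ⨾ (id ⊗₁ ε*) ⨾ δ*) ⨾ ε       ≡⟨ assoc₃ ρ⇐ (id ⊗₁ ε*) δ* ε ⟩
    member ε*                        ∎

  ⨾ε-via-graph : ∀ {X Y} (R : Hom X Y) → R ⨾ ε ≡ ρ⇐ ⨾ (id ⊗₁ ε*) ⨾ (R ⊗₁ id) ⨾ cap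
  ⨾ε-via-graph R = begin-equality
    R ⨾ ε                                  ≡⟨ cong (R ⨾_) ε≡member-ε* ⟩
    R ⨾ ρ⇐ ⨾ (id ⊗₁ ε*) ⨾ cap              ≡⟨ extend (ρ⇐-natural R) ⟨
    ρ⇐ ⨾ (R ⊗₁ id) ⨾ (id ⊗₁ ε*) ⨾ cap      ≡⟨ cong (ρ⇐ ⨾_) (extend (⊗-slide R ε*)) ⟩
    ρ⇐ ⨾ (id ⊗₁ ε*) ⨾ (R ⊗₁ id) ⨾ cap      ∎

  °⨾ε≡member : ∀ {X Y} (R : Hom X Y) → R ° ⨾ ε ≡ member (ε* ⨾ R)
  °⨾ε≡member R = begin-equality
    R ° ⨾ ε                                   ≡⟨ cong (_⨾ ε) (°≡bend R) ⟩
    bend (cup ⨾ (R ⊗₁ id)) cap ⨾ ε            ≡⟨ bend-⨾ʳ _ cap ε ⟩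
    bend ((cup ⨾ (R ⊗₁ id)) ⨾ (id ⊗₁ ε)) cap  ≡⟨ cong (λ N → bend N cap) image ⟩
    bend ((ε* ⨾ R) ⨾ ρ⇐) cap                  ≡⟨ bend-point _ cap ⟩
    member (ε* ⨾ R)                           ∎
    where
    image : (cup ⨾ (R ⊗₁ id)) ⨾ (id ⊗₁ ε) ≡ (ε* ⨾ R) ⨾ ρ⇐
    image = begin-equality
      ((ε* ⨾ δ) ⨾ (R ⊗₁ id)) ⨾ (id ⊗₁ ε)
        ≡⟨ trans (assoc _ _ _) (trans (assoc _ _ _) (cong (λ h → ε* ⨾ δ ⨾ h) (⊗-slide R ε))) ⟩
      ε* ⨾ δ ⨾ (id ⊗₁ ε) ⨾ (R ⊗₁ id)
        ≡⟨ cong (ε* ⨾_) (trans (pullˡ δ⨾id⊗ε) (ρ⇐-natural R)) ⟩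
      ε* ⨾ R ⨾ ρ⇐
        ≡⟨ assoc _ _ _ ⟨
      (ε* ⨾ R) ⨾ ρ⇐ ∎

  surjective⇒°-total : ∀ {X Y} (π : Hom X Y) → Surjective C π → Total C (π °)
  surjective⇒°-total π surjective = begin
    ε                  ≡⟨ ε≡member-ε* ⟩
    member ε*          ≤⟨ ⨾-monoʳ ρ⇐ (⨾-monoˡ cap (⊗-monoʳ id surjective)) ⟩
    member (ε* ⨾ π)    ≡⟨ °⨾ε≡member π ⟨
    π ° ⨾ ε            ∎

  member-⨾ : ∀ {X Y} (t : Hom I X) (g : Hom X Y) → Total C g → member t ≤ g ⨾ member (t ⨾ g)
  member-⨾ t g total = begin
    ρ⇐ ⨾ (id ⊗₁ t) ⨾ cap                     ≤⟨ ⨾-monoʳ ρ⇐ (⨾-monoʳ (id ⊗₁ t) (cap-total g total)) ⟩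
    ρ⇐ ⨾ (id ⊗₁ t) ⨾ (g ⊗₁ g) ⨾ cap          ≡⟨ cong (ρ⇐ ⨾_) (pullˡ (id⊗⨾⊗ t g g)) ⟩
    ρ⇐ ⨾ (g ⊗₁ (t ⨾ g)) ⨾ cap                ≡⟨ cong (ρ⇐ ⨾_) (pushˡ (sym (⊗id⨾id⊗ g (t ⨾ g)))) ⟩
    ρ⇐ ⨾ (g ⊗₁ id) ⨾ (id ⊗₁ (t ⨾ g)) ⨾ cap   ≡⟨ extend (ρ⇐-natural g) ⟩
    g ⨾ member (t ⨾ g)                       ∎


module Projections {o ℓ e : Level} (C : CartesianBicategory o ℓ e) where
  open CartesianBicategory C
  open HomReasoning C
  open Coherence C
  open Comonoid C
  open ≤-Reasoning

  π₁ : ∀ {X Y} → Hom (X ⊗₀ Y) X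
  π₁ = (id ⊗₁ ε) ⨾ ρ⇒

  π₂ : ∀ {X Y} → Hom (X ⊗₀ Y) Y
  π₂ = (ε ⊗₁ id) ⨾ λ⇒

  δ⨾⊗-shuffle : ∀ {A B A₁ A₂ B₁ B₂ D₁ D₂}
                  (u : Hom A A₁) (v : Hom B B₁) (c : Hom (A₁ ⊗₀ B₁) D₁)
                  (u′ : Hom A A₂) (v′ : Hom B B₂) (c′ : Hom (A₂ ⊗₀ B₂) D₂) →
                δ ⨾ (((u ⊗₁ v) ⨾ c) ⊗₁ ((u′ ⊗₁ v′) ⨾ c′)) ≡ ((δ ⨾ (u ⊗₁ u′)) ⊗₁ (δ ⨾ (v ⊗₁ v′))) ⨾ shuffle ⨾ (c ⊗₁ c′)
  δ⨾⊗-shuffle u v c u′ v′ c′ = begin-equality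
    δ ⨾ (((u ⊗₁ v) ⨾ c) ⊗₁ ((u′ ⊗₁ v′) ⨾ c′))
      ≡⟨ cong₂ _⨾_ δ-⊗′ (⊗-⨾ _ _ _ _) ⟩
    ((δ ⊗₁ δ) ⨾ shuffle) ⨾ ((u ⊗₁ v) ⊗₁ (u′ ⊗₁ v′)) ⨾ (c ⊗₁ c′)
      ≡⟨ trans (assoc _ _ _) (cong ((δ ⊗₁ δ) ⨾_) (extend (shuffle-natural u u′ v v′))) ⟩
    (δ ⊗₁ δ) ⨾ ((u ⊗₁ u′) ⊗₁ (v ⊗₁ v′)) ⨾ shuffle ⨾ (c ⊗₁ c′)
      ≡⟨ pullˡ (sym (⊗-⨾ _ _ _ _)) ⟩
    ((δ ⨾ (u ⊗₁ u′)) ⊗₁ (δ ⨾ (v ⊗₁ v′))) ⨾ shuffle ⨾ (c ⊗₁ c′) ∎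

  δ⨾ε⊗ε : ∀ {X} → δ {X} ⨾ (ε ⊗₁ ε) ≡ ε ⨾ λ⇐
  δ⨾ε⊗ε = trans (cong (δ ⨾_) (sym (⊗id⨾id⊗ ε ε))) (trans (pullˡ δ⨾ε⊗id) (λ⇐-natural ε))

  δ⨾id⊗id : ∀ {X} → δ {X} ⨾ (id ⊗₁ id) ≡ δ
  δ⨾id⊗id = trans (cong (δ ⨾_) ⊗-id) (identityʳ δ)

  π₁-singleValued : ∀ {X Y} → δ ⨾ (π₁ {X} {Y} ⊗₁ π₁) ≡ π₁ ⨾ δ
  π₁-singleValued = begin-equality
    δ ⨾ (π₁ ⊗₁ π₁)
      ≡⟨ δ⨾⊗-shuffle id ε ρ⇒ id ε ρ⇒ ⟩
    ((δ ⨾ (id ⊗₁ id)) ⊗₁ (δ ⨾ (ε ⊗₁ ε))) ⨾ shuffle ⨾ (ρ⇒ ⊗₁ ρ⇒)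
      ≡⟨ cong (_⨾ shuffle ⨾ (ρ⇒ ⊗₁ ρ⇒)) (trans (cong₂ _⊗₁_ δ⨾id⊗id δ⨾ε⊗ε) (sym (⊗⨾id⊗ δ ε λ⇐))) ⟩
    ((δ ⊗₁ ε) ⨾ (id ⊗₁ λ⇐)) ⨾ shuffle ⨾ (ρ⇒ ⊗₁ ρ⇒)
      ≡⟨ trans (assoc _ _ _) (cong ((δ ⊗₁ ε) ⨾_) coherence) ⟩
    (δ ⊗₁ ε) ⨾ ρ⇒
      ≡⟨ pullˡ (id⊗⨾⊗id δ ε) ⟨
    (id ⊗₁ ε) ⨾ (δ ⊗₁ id) ⨾ ρ⇒
      ≡⟨ trans (cong ((id ⊗₁ ε) ⨾_) (ρ⇒-natural δ)) (sym (assoc _ _ _)) ⟩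
    π₁ ⨾ δ ∎

  π₂-singleValued : ∀ {X Y} → δ ⨾ (π₂ {X} {Y} ⊗₁ π₂) ≡ π₂ ⨾ δ
  π₂-singleValued = begin-equality
    δ ⨾ (π₂ ⊗₁ π₂)
      ≡⟨ δ⨾⊗-shuffle ε id λ⇒ ε id λ⇒ ⟩
    ((δ ⨾ (ε ⊗₁ ε)) ⊗₁ (δ ⨾ (id ⊗₁ id))) ⨾ shuffle ⨾ (λ⇒ ⊗₁ λ⇒)
      ≡⟨ cong (_⨾ shuffle ⨾ (λ⇒ ⊗₁ λ⇒)) (trans (cong₂ _⊗₁_ δ⨾ε⊗ε δ⨾id⊗id) (sym (⊗⨾⊗id ε δ λ⇐))) ⟩
    ((ε ⊗₁ δ) ⨾ (λ⇐ ⊗₁ id)) ⨾ shuffle ⨾ (λ⇒ ⊗₁ λ⇒)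
      ≡⟨ trans (assoc _ _ _) (cong ((ε ⊗₁ δ) ⨾_) coherence) ⟩
    (ε ⊗₁ δ) ⨾ λ⇒
      ≡⟨ pullˡ (⊗id⨾id⊗ ε δ) ⟨
    (ε ⊗₁ id) ⨾ (id ⊗₁ δ) ⨾ λ⇒
      ≡⟨ trans (cong ((ε ⊗₁ id) ⨾_) (λ⇒-natural δ)) (sym (assoc _ _ _)) ⟩
    π₂ ⨾ δ ∎
    where
    instance
      σ-unitˡ : ∀ {X} → Structural (σ {I} {X})
      σ-unitˡ = σ-unitˡ-structural

  δ⨾π₁⊗π₂ : ∀ {X Y} → δ ⨾ (π₁ {X} {Y} ⊗₁ π₂) ≡ id
  δ⨾π₁⊗π₂ = begin-equality
    δ ⨾ (π₁ ⊗₁ π₂)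
      ≡⟨ δ⨾⊗-shuffle id ε ρ⇒ ε id λ⇒ ⟩
    ((δ ⨾ (id ⊗₁ ε)) ⊗₁ (δ ⨾ (ε ⊗₁ id))) ⨾ shuffle ⨾ (ρ⇒ ⊗₁ λ⇒)
      ≡⟨ cong (_⨾ shuffle ⨾ (ρ⇒ ⊗₁ λ⇒)) (cong₂ _⊗₁_ δ⨾id⊗ε δ⨾ε⊗id) ⟩
    (ρ⇐ ⊗₁ λ⇐) ⨾ shuffle ⨾ (ρ⇒ ⊗₁ λ⇒)
      ≡⟨ coherence ⟩
    id ∎

  π₁⨾ε : ∀ {X Y} → π₁ {X} {Y} ⨾ ε ≡ ε
  π₁⨾ε = sym (begin-equality
    ε                              ≡⟨ ε-⊗′ ⟩
    (ε ⊗₁ ε) ⨾ λ⇒                  ≡⟨ cong ((ε ⊗₁ ε) ⨾_) coherence ⟩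
    (ε ⊗₁ ε) ⨾ ρ⇒                  ≡⟨ pullˡ (id⊗⨾⊗id ε ε) ⟨
    (id ⊗₁ ε) ⨾ (ε ⊗₁ id) ⨾ ρ⇒     ≡⟨ trans (cong ((id ⊗₁ ε) ⨾_) (ρ⇒-natural ε)) (sym (assoc _ _ _)) ⟩
    π₁ ⨾ ε                         ∎)

  π₂⨾ε : ∀ {X Y} → π₂ {X} {Y} ⨾ ε ≡ ε
  π₂⨾ε = sym (begin-equality
    ε                              ≡⟨ ε-⊗′ ⟩
    (ε ⊗₁ ε) ⨾ λ⇒                  ≡⟨ pullˡ (⊗id⨾id⊗ ε ε) ⟨
    (ε ⊗₁ id) ⨾ (id ⊗₁ ε) ⨾ λ⇒     ≡⟨ trans (cong ((ε ⊗₁ id) ⨾_) (λ⇒-natural ε)) (sym (assoc _ _ _)) ⟩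
    π₂ ⨾ ε                         ∎)

  π₁-map : ∀ {X Y} → IsMap C (π₁ {X} {Y})
  π₁-map = ≤-reflexive π₁-singleValued , ≤-reflexive (sym π₁⨾ε)

  π₂-map : ∀ {X Y} → IsMap C (π₂ {X} {Y})
  π₂-map = ≤-reflexive π₂-singleValued , ≤-reflexive (sym π₂⨾ε)

  ≤-pairing : ∀ {X A B} (k : Hom X (A ⊗₀ B)) → k ≤ δ ⨾ ((k ⨾ π₁) ⊗₁ (k ⨾ π₂))
  ≤-pairing k = begin
    k                                ≡⟨ cancelʳ δ⨾π₁⊗π₂ ⟨
    k ⨾ δ ⨾ (π₁ ⊗₁ π₂)               ≡⟨ assoc _ _ _ ⟨
    (k ⨾ δ) ⨾ (π₁ ⊗₁ π₂)             ≤⟨ ⨾-monoˡ _ (δ-lax k) ⟩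
    (δ ⨾ (k ⊗₁ k)) ⨾ (π₁ ⊗₁ π₂)      ≡⟨ trans (assoc _ _ _) (cong (δ ⨾_) (sym (⊗-⨾ k π₁ k π₂))) ⟩
    δ ⨾ ((k ⨾ π₁) ⊗₁ (k ⨾ π₂))       ∎

  ρ⇐⨾id⊗ε*⨾π₁ : ∀ {X Y} → ρ⇐ ⨾ (id ⊗₁ ε* {Y}) ⨾ π₁ ≤ id {X}
  ρ⇐⨾id⊗ε*⨾π₁ = begin
    ρ⇐ ⨾ (id ⊗₁ ε*) ⨾ (id ⊗₁ ε) ⨾ ρ⇒
      ≡⟨ cong (ρ⇐ ⨾_) (pullˡ (sym (id⊗-⨾ ε* ε))) ⟩
    ρ⇐ ⨾ (id ⊗₁ (ε* ⨾ ε)) ⨾ ρ⇒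
      ≤⟨ ⨾-monoʳ ρ⇐ (⨾-monoˡ ρ⇒ (⊗-monoʳ id ε-counit)) ⟩
    ρ⇐ ⨾ (id ⊗₁ id) ⨾ ρ⇒
      ≡⟨ trans (cong (λ h → ρ⇐ ⨾ h ⨾ ρ⇒) ⊗-id) (trans (cong (ρ⇐ ⨾_) (identityˡ ρ⇒)) ρ⇐⨾ρ⇒) ⟩
    id ∎


module Intersections {o ℓ e : Level} (C : CartesianBicategory o ℓ e) where
  open CartesianBicategory C
  open HomReasoning C
  open Coherence C
  open Comonoid C
  open Relations C
  open ≤-Reasoning

  infixr 8 _∩_
  _∩_ : ∀ {X Y} → Hom X Y → Hom X Y → Hom X Y
  R ∩ S = δ ⨾ (R ⊗₁ S) ⨾ δ*

  ≤ε⨾ε* : ∀ {X Y} (R : Hom X Y) → R ≤ ε ⨾ ε*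
  ≤ε⨾ε* R = begin
    R               ≡⟨ identityʳ R ⟨
    R ⨾ id          ≤⟨ ⨾-monoʳ R ε-unit ⟩
    R ⨾ ε ⨾ ε*      ≡⟨ assoc _ _ _ ⟨
    (R ⨾ ε) ⨾ ε*    ≤⟨ ⨾-monoˡ ε* (ε-lax R) ⟩
    ε ⨾ ε*          ∎

  ∩-≤ˡ : ∀ {X Y} (R S : Hom X Y) → R ∩ S ≤ R
  ∩-≤ˡ R S = begin
    δ ⨾ (R ⊗₁ S) ⨾ δ*
      ≤⟨ ⨾-monoʳ δ (⨾-monoˡ δ* (⊗-monoʳ R (≤ε⨾ε* S))) ⟩
    δ ⨾ (R ⊗₁ (ε ⨾ ε*)) ⨾ δ*
      ≡⟨ cong (δ ⨾_) (pushˡ (trans (cong (_⊗₁ (ε ⨾ ε*)) (sym (identityˡ R))) (⊗-⨾ id R ε ε*))) ⟩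
    δ ⨾ (id ⊗₁ ε) ⨾ (R ⊗₁ ε*) ⨾ δ*
      ≡⟨ pullˡ δ⨾id⊗ε ⟩
    ρ⇐ ⨾ (R ⊗₁ ε*) ⨾ δ*
      ≡⟨ cong (ρ⇐ ⨾_) (pushˡ (sym (⊗id⨾id⊗ R ε*))) ⟩
    ρ⇐ ⨾ (R ⊗₁ id) ⨾ (id ⊗₁ ε*) ⨾ δ*
      ≡⟨ extend (ρ⇐-natural R) ⟩
    R ⨾ ρ⇐ ⨾ (id ⊗₁ ε*) ⨾ δ*
      ≡⟨ trans (cong (R ⨾_) ρ⇐⨾id⊗ε*⨾δ*) (identityʳ R) ⟩
    R ∎

  ≤-guarded : ∀ {X Y} (T : Hom X I) (g : Hom X Y) → ε ≤ T → g ≤ δ ⨾ (T ⊗₁ g) ⨾ λ⇒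
  ≤-guarded T g ε≤T = begin
    g                       ≡⟨ trans (assoc _ _ _) (cancelʳ λ⇐⨾λ⇒) ⟨
    (g ⨾ λ⇐) ⨾ λ⇒           ≡⟨ pullˡ (δ⨾ε⊗ g) ⟨
    δ ⨾ (ε ⊗₁ g) ⨾ λ⇒       ≤⟨ ⨾-monoʳ δ (⨾-monoˡ λ⇒ (⊗-monoˡ g ε≤T)) ⟩
    δ ⨾ (T ⊗₁ g) ⨾ λ⇒       ∎

  guard-∩ : ∀ {X Y} (R S : Hom X Y) →
            δ ⨾ (((R ∩ S) ⨾ ε) ⊗₁ S) ⨾ λ⇒ ≡ δ ⨾ (R ⊗₁ (δ ⨾ (S ⊗₁ S))) ⨾ α⇐ ⨾ (cap ⊗₁ id) ⨾ λ⇒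
  guard-∩ R S = begin-equality
    δ ⨾ (((R ∩ S) ⨾ ε) ⊗₁ S) ⨾ λ⇒
      ≡⟨ cong (λ h → δ ⨾ h ⨾ λ⇒) split ⟩
    δ ⨾ ((δ ⊗₁ id) ⨾ ((R ⊗₁ S) ⊗₁ S) ⨾ (cap ⊗₁ id)) ⨾ λ⇒
      ≡⟨ cong (δ ⨾_) (assoc₃ _ _ _ λ⇒) ⟩
    δ ⨾ (δ ⊗₁ id) ⨾ ((R ⊗₁ S) ⊗₁ S) ⨾ (cap ⊗₁ id) ⨾ λ⇒
      ≡⟨ trans (extend δ-coassoc′) (cong (δ ⨾_) (assoc _ _ _)) ⟩
    δ ⨾ (id ⊗₁ δ) ⨾ α⇐ ⨾ ((R ⊗₁ S) ⊗₁ S) ⨾ (cap ⊗₁ id) ⨾ λ⇒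
      ≡⟨ cong (λ h → δ ⨾ (id ⊗₁ δ) ⨾ h) (extend (α⇐-natural R S S)) ⟩
    δ ⨾ (id ⊗₁ δ) ⨾ (R ⊗₁ (S ⊗₁ S)) ⨾ α⇐ ⨾ (cap ⊗₁ id) ⨾ λ⇒
      ≡⟨ cong (δ ⨾_) (pullˡ (id⊗⨾⊗ δ R (S ⊗₁ S))) ⟩
    δ ⨾ (R ⊗₁ (δ ⨾ (S ⊗₁ S))) ⨾ α⇐ ⨾ (cap ⊗₁ id) ⨾ λ⇒ ∎
    where
    split : ((R ∩ S) ⨾ ε) ⊗₁ S ≡ (δ ⊗₁ id) ⨾ ((R ⊗₁ S) ⊗₁ S) ⨾ (cap ⊗₁ id)
    split = begin-equality
      ((δ ⨾ (R ⊗₁ S) ⨾ δ*) ⨾ ε) ⊗₁ S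
        ≡⟨ cong₂ _⊗₁_ (assoc₃ δ (R ⊗₁ S) δ* ε) (sym (trans (identityˡ _) (identityʳ S))) ⟩
      (δ ⨾ (R ⊗₁ S) ⨾ cap) ⊗₁ (id ⨾ S ⨾ id)
        ≡⟨ ⊗-⨾ _ _ _ _ ⟩
      (δ ⊗₁ id) ⨾ (((R ⊗₁ S) ⨾ cap) ⊗₁ (S ⨾ id))
        ≡⟨ cong ((δ ⊗₁ id) ⨾_) (⊗-⨾ _ _ _ _) ⟩
      (δ ⊗₁ id) ⨾ ((R ⊗₁ S) ⊗₁ S) ⨾ (cap ⊗₁ id) ∎

  frobenius-∩ : ∀ {X Y} (R S : Hom X Y) → δ ⨾ (R ⊗₁ (S ⨾ δ)) ⨾ α⇐ ⨾ (cap ⊗₁ id) ⨾ λ⇒ ≡ R ∩ S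
  frobenius-∩ R S = begin-equality
    δ ⨾ (R ⊗₁ (S ⨾ δ)) ⨾ α⇐ ⨾ (cap ⊗₁ id) ⨾ λ⇒
      ≡⟨ cong (δ ⨾_) (pushˡ (sym (⊗⨾id⊗ R S δ))) ⟩
    δ ⨾ (R ⊗₁ S) ⨾ (id ⊗₁ δ) ⨾ α⇐ ⨾ (cap ⊗₁ id) ⨾ λ⇒
      ≡⟨ cong (λ h → δ ⨾ (R ⊗₁ S) ⨾ (id ⊗₁ δ) ⨾ α⇐ ⨾ h) (pushˡ (⨾-⊗id δ* ε)) ⟩
    δ ⨾ (R ⊗₁ S) ⨾ (id ⊗₁ δ) ⨾ α⇐ ⨾ (δ* ⊗₁ id) ⨾ (ε ⊗₁ id) ⨾ λ⇒
      ≡⟨ cong (λ h → δ ⨾ (R ⊗₁ S) ⨾ h) (trans (pull₃ˡ frobenius′) (trans (assoc _ _ _) (cong (δ* ⨾_) δ⨾ε⊗id⨾λ⇒))) ⟩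
    δ ⨾ (R ⊗₁ S) ⨾ δ* ⨾ id
      ≡⟨ cong (λ h → δ ⨾ (R ⊗₁ S) ⨾ h) (identityʳ δ*) ⟩
    R ∩ S ∎

  singleValued⇒≤∩ : ∀ {X Y} (R : Hom X Y) {g : Hom X Y} → SingleValued C g → Total C (R ∩ g) → g ≤ R ∩ g
  singleValued⇒≤∩ R {g} singleValued total = begin
    g                                                   ≤⟨ ≤-guarded _ g total ⟩
    δ ⨾ (((R ∩ g) ⨾ ε) ⊗₁ g) ⨾ λ⇒                       ≡⟨ guard-∩ R g ⟩
    δ ⨾ (R ⊗₁ (δ ⨾ (g ⊗₁ g))) ⨾ α⇐ ⨾ (cap ⊗₁ id) ⨾ λ⇒   ≤⟨ ⨾-monoʳ δ (⨾-monoˡ _ (⊗-monoʳ R singleValued)) ⟩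
    δ ⨾ (R ⊗₁ (g ⨾ δ)) ⨾ α⇐ ⨾ (cap ⊗₁ id) ⨾ λ⇒          ≡⟨ frobenius-∩ R g ⟩
    R ∩ g                                               ∎


module Choice {o ℓ e : Level} (C : CartesianBicategory o ℓ e) where
  open CartesianBicategory C
  open HomReasoning C
  open Coherence C
  open Relations C
  open Points C
  open Projections C
  open Intersections C
  open ≤-Reasoning

  choice⇒split : AxiomOfChoice C → SurjectiveMapsSplit C
  choice⇒split choice π π-map π-surjective =
    let h , h-map , h≤π° = choice (π °) (surjective⇒°-total π π-surjective) in
    h , h-map , map≤id⇒≡id (map-⨾ h-map π-map) (begin
      h ⨾ π      ≤⟨ ⨾-monoˡ π h≤π° ⟩
      π ° ⨾ π    ≤⟨ singleValued⇒°⨾≤id π (proj₁ π-map) ⟩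
      id         ∎)

  -- The image of f is the graph of R.
  Tabulates : ∀ {X Y Z} → Hom Z (X ⊗₀ Y) → Hom X Y → Set ℓ
  Tabulates f R = (R ⊗₁ id) ⨾ cap ≡ f ° ⨾ ε

  tabulation-surjective : ∀ {X Y Z} {R : Hom X Y} {f : Hom Z (X ⊗₀ Y)} →
                          Total C R → Tabulates f R → Surjective C (f ⨾ π₁)
  tabulation-surjective {R = R} {f} total tabulates =
    ≤-trans (member-total⇒ε*≤ _ member-total) (≤-reflexive (assoc ε* f π₁))
    where
    member-total : ε ≤ member ((ε* ⨾ f) ⨾ π₁)
    member-total = begin
      ε
        ≤⟨ total ⟩
      R ⨾ ε
        ≡⟨ ⨾ε-via-graph R ⟩
      ρ⇐ ⨾ (id ⊗₁ ε*) ⨾ (R ⊗₁ id) ⨾ cap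
        ≡⟨ cong (λ k → ρ⇐ ⨾ (id ⊗₁ ε*) ⨾ k) (trans tabulates (°⨾ε≡member f)) ⟩
      ρ⇐ ⨾ (id ⊗₁ ε*) ⨾ member (ε* ⨾ f)
        ≤⟨ ⨾-monoʳ ρ⇐ (⨾-monoʳ _ (member-⨾ _ π₁ (proj₂ π₁-map))) ⟩
      ρ⇐ ⨾ (id ⊗₁ ε*) ⨾ π₁ ⨾ member ((ε* ⨾ f) ⨾ π₁)
        ≡⟨ assoc₃ _ _ _ _ ⟨
      (ρ⇐ ⨾ (id ⊗₁ ε*) ⨾ π₁) ⨾ member ((ε* ⨾ f) ⨾ π₁)
        ≤⟨ ⨾-monoˡ _ ρ⇐⨾id⊗ε*⨾π₁ ⟩
      id ⨾ member ((ε* ⨾ f) ⨾ π₁)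
        ≡⟨ identityˡ _ ⟩
      member ((ε* ⨾ f) ⨾ π₁) ∎

  tabulation-section≤ : ∀ {X Y Z} {R : Hom X Y} {f : Hom Z (X ⊗₀ Y)} {h : Hom X Z} →
                        IsMap C f → Tabulates f R → IsMap C h → h ⨾ f ⨾ π₁ ≡ id → h ⨾ f ⨾ π₂ ≤ R
  tabulation-section≤ {X} {Y} {R = R} {f} {h} f-map tabulates h-map section =
    ≤-trans (singleValued⇒≤∩ R (proj₁ g-map) meet-total) (∩-≤ˡ R g)
    where
    g : Hom X Y
    g = h ⨾ f ⨾ π₂
    g-map : IsMap C g
    g-map = map-⨾ h-map (map-⨾ f-map π₂-map)
    h⨾f≤ : h ⨾ f ≤ δ ⨾ (id ⊗₁ g)
    h⨾f≤ = ≤-trans (≤-pairing (h ⨾ f))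
      (≤-reflexive (cong (δ ⨾_) (cong₂ _⊗₁_ (trans (assoc h f π₁) section) (assoc h f π₂))))
    meet-total : Total C (R ∩ g)
    meet-total = begin
      ε                                    ≤⟨ proj₂ h-map ⟩
      h ⨾ ε                                ≡⟨ cong (h ⨾_) (identityˡ ε) ⟨
      h ⨾ id ⨾ ε                           ≤⟨ ⨾-monoʳ h (⨾-monoˡ ε (total⇒id≤⨾° f (proj₂ f-map))) ⟩
      h ⨾ (f ⨾ f °) ⨾ ε                    ≡⟨ cong (h ⨾_) (trans (assoc _ _ _) (cong (f ⨾_) (sym tabulates))) ⟩
      h ⨾ f ⨾ (R ⊗₁ id) ⨾ cap              ≡⟨ assoc _ _ _ ⟨
      (h ⨾ f) ⨾ (R ⊗₁ id) ⨾ cap            ≤⟨ ⨾-monoˡ _ h⨾f≤ ⟩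
      (δ ⨾ (id ⊗₁ g)) ⨾ (R ⊗₁ id) ⨾ cap    ≡⟨ trans (assoc _ _ _) (cong (δ ⨾_) (pullˡ (id⊗⨾⊗id R g))) ⟩
      δ ⨾ (R ⊗₁ g) ⨾ δ* ⨾ ε                ≡⟨ assoc₃ δ (R ⊗₁ g) δ* ε ⟨
      (R ∩ g) ⨾ ε                          ∎

  split⇒choice : EnoughMaps C → SurjectiveMapsSplit C → AxiomOfChoice C
  split⇒choice enough split R total =
    let Z , f , f-map , tabulates = enough ((R ⊗₁ id) ⨾ cap)
        h , h-map , section = split (f ⨾ π₁) (map-⨾ f-map π₁-map) (tabulation-surjective total tabulates)
    in h ⨾ f ⨾ π₂ , map-⨾ h-map (map-⨾ f-map π₂-map) , tabulation-section≤ f-map tabulates h-map section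

proposition4p10 : ∀ {o ℓ e : Level} (C : CartesianBicategory o ℓ e) →
    EnoughMaps C → (AxiomOfChoice C ⇔ SurjectiveMapsSplit C)
proposition4p10 C enough = mk⇔ (Choice.choice⇒split C) (Choice.split⇒choice C enough)
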